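{- For integers $a\ge1$, $k,\ell\ge0$ and a composition $\beta$ with $\ell(\beta)$ parts, $$\overline{\rm Cat}^{\rm Rise}_{(a+1,\beta),k,\ell}(q,t)=t^aq^{\ell(\beta)}\sum_{\gamma\models a}\overline{\rm Cat}^{\rm Rise}_{(\beta,\gamma),k,\ell}(q,t)+t^aq^{\ell(\beta)}\sum_{\gamma\models a+1}\overline{\rm Cat}^{\rm Rise}_{(\beta,\gamma),k,\ell-1}(q,t),$$ where $(\beta,\gamma)$ denotes concatenation and a term with index $\ell-1<0$ is $0$.
   Context: A Dyck path $D\in\mathcal D_n$ is encoded by its area sequence $(a_1,\dots,a_n)$ with $a_1=0$ and $0\le a_{i+1}\le a_i+1$; ${\rm area}(D)=\sum_ia_i$. For row $i$ let $b_i(D)=\#\{j>i: a_j=a_i\}+\#\{j<i: a_j=a_i+1\}$ and ${\rm dinv}(D)=\sum_ib_i(D)$. Row $i$ is a double rise if $i<n$ and $a_{i+1}=a_i+1$, and a peak otherwise. Let $i_0$ be the largest index $i$ with $a_i=\max_ja_j$. A $\circ$-decorated Dyck path is a Dyck path together with a set of decorated rows not containing $i_0$; $\mathcal D^\circ_n$ denotes the set of these. ${\rm Rise}_\circ(D)$ is the set of decorated double rises, ${\rm Peak}_\circ(D)$ the set of decorated peaks, ${\rm peak}_\circ(D)=|{\rm Peak}_\circ(D)|$. ${\rm area}_\circ(D)={\rm area}(D)-\sum_{i\in{\rm Rise}_\circ(D)}a_{i+1}$, ${\rm dinv}_\circ(D)={\rm dinv}(D)-\sum_{i\in{\rm Peak}_\circ(D)}b_i(D)$.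 If $1=j_1<\dots<j_p$ are the indices with $a_j=0$ and $j_{p+1}=n+1$, the rise-touch composition $\alpha^{\rm Rise}(D)$ has $s$-th part $j_{s+1}-j_s$ minus the number of decorated double rises among rows $j_s,\dots,j_{s+1}-1$. For a composition $\alpha$ and $k,\ell\ge0$, $\overline{\rm Cat}^{\rm Rise}_{\alpha,k,\ell}(q,t)=\sum q^{{\rm dinv}_\circ(D)}t^{{\rm area}_\circ(D)}$ over $D\in\mathcal D^\circ_{|\alpha|+\ell}$ with ${\rm peak}_\circ(D)=k$ and $\alpha^{\rm Rise}(D)=\alpha$. $\gamma\models a$ means $\gamma$ is a composition of $a$. -}

module Defs where

open import Data.Nat using (ℕ; zero; suc; _+_; _∸_; _⊔_; _≡ᵇ_; _<ᵇ_; _≟_)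
open import Data.Bool using (Bool; true; false; _∧_; _∨_; not; if_then_else_)
open import Data.List using (List; []; _∷_; _++_; map; concatMap; filterᵇ; length; foldr; zip; upTo)
open import Data.Nat.ListAction using (sum)
open import Data.List.Properties using (≡-dec)
open import Data.Maybe using (Maybe; just; nothing)
open import Data.Product using (_×_; _,_; proj₁; proj₂)
open import Relation.Nullary using (does)
open import Relation.Binary.PropositionalEquality using (_≡_)

-- Bivariate polynomials in q,t with natural coefficients, represented
-- as a finite multiset (list) of monomials q^i t^j, written (i , j).

Poly : Set
Poly = List (ℕ × ℕ)

coeff : Poly → ℕ → ℕ → ℕ
coeff [] i j = 0
coeff ((x , y) ∷ p) i j = (if (x ≡ᵇ i) ∧ (y ≡ᵇ j) then 1 else 0) + coeff p i j

_≈P_ : Poly → Poly → Set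
P ≈P Q = ∀ i j → coeff P i j ≡ coeff Q i j

qtShift : ℕ → ℕ → Poly → Poly
qtShift x y = map (λ m → (proj₁ m + x , proj₂ m + y))

-- Lists / indices (rows are 0-based here)

get : List ℕ → ℕ → Maybe ℕ
get [] _ = nothing
get (x ∷ xs) zero = just x
get (x ∷ xs) (suc i) = get xs i

getB : List Bool → ℕ → Bool
getB [] _ = false
getB (x ∷ xs) zero = x
getB (x ∷ xs) (suc i) = getB xs i

indexed : {A : Set} → List A → List (ℕ × A)
indexed xs = zip (upTo (length xs)) xs

-- Dyck paths of size n, as area sequences (a_1,...,a_n):
-- a_1 = 0 and 0 ≤ a_{i+1} ≤ a_i + 1.

-- sequences of length m continuing after a previous entry p
areaTail : ℕ → ℕ → List (List ℕ)
areaTail p zero = [] ∷ []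
areaTail p (suc m) = concatMap (λ x → map (x ∷_) (areaTail x m)) (upTo (suc (suc p)))

dyckPaths : ℕ → List (List ℕ)
dyckPaths zero = [] ∷ []
dyckPaths (suc n) = map (0 ∷_) (areaTail 0 n)

area : List ℕ → ℕ
area = sum

bStat : List ℕ → ℕ → ℕ → ℕ
bStat a i ai = length (filterᵇ (λ p →
      ((i <ᵇ proj₁ p) ∧ (proj₂ p ≡ᵇ ai)) ∨ ((proj₁ p <ᵇ i) ∧ (proj₂ p ≡ᵇ suc ai)))
  (indexed a))

dinv : List ℕ → ℕ
dinv a = sum (map (λ p → bStat a (proj₁ p) (proj₂ p)) (indexed a))

isRise : List ℕ → ℕ → Bool
isRise a i with get a i | get a (suc i)
... | just ai | just aj = aj ≡ᵇ suc ai
... | _ | _ = false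

maxEntry : List ℕ → ℕ
maxEntry = foldr _⊔_ 0

lastMaxIndex : List ℕ → ℕ
lastMaxIndex a = foldr (λ p acc → if proj₂ p ≡ᵇ maxEntry a then proj₁ p ⊔ acc else acc) 0 (indexed a)

-- Decorated Dyck paths: a path together with a decoration vector
-- (List Bool of length n, true = decorated row), row i_0 not decorated.

allBools : ℕ → List (List Bool)
allBools zero = [] ∷ []
allBools (suc n) = concatMap (λ d → (false ∷ d) ∷ (true ∷ d) ∷ []) (allBools n)

DecPath : Set
DecPath = List ℕ × List Bool

decoratedPaths : ℕ → List DecPath
decoratedPaths n = concatMap
  (λ a → map (a ,_) (filterᵇ (λ d → not (getB d (lastMaxIndex a))) (allBools n)))
  (dyckPaths n)

rowsOf : DecPath → List (ℕ × ℕ × Bool)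
rowsOf (a , d) = zip (upTo (length a)) (zip a d)

-- Σ_{i ∈ Rise∘} a_{i+1}
riseDecSum : DecPath → ℕ
riseDecSum (a , d) = sum (map (λ r → if proj₂ (proj₂ r) ∧ isRise a (proj₁ r) then suc (proj₁ (proj₂ r)) else 0) (rowsOf (a , d)))

-- Σ_{i ∈ Peak∘} b_i
peakDecSum : DecPath → ℕ
peakDecSum (a , d) = sum (map (λ r → if proj₂ (proj₂ r) ∧ not (isRise a (proj₁ r)) then bStat a (proj₁ r) (proj₁ (proj₂ r)) else 0) (rowsOf (a , d)))

peakDec : DecPath → ℕ
peakDec (a , d) = length (filterᵇ (λ r → proj₂ (proj₂ r) ∧ not (isRise a (proj₁ r))) (rowsOf (a , d)))

areaDec : DecPath → ℕ
areaDec (a , d) = area a ∸ riseDecSum (a , d)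

dinvDec : DecPath → ℕ
dinvDec (a , d) = dinv a ∸ peakDecSum (a , d)

-- rise-touch composition: for each segment between consecutive zeros of
-- the area sequence, its length minus the number of decorated double rises in it
riseComp : DecPath → List ℕ
riseComp (a , d) = proj₂ (foldr step (0 , []) (rowsOf (a , d)))
  where
  step : ℕ × ℕ × Bool → ℕ × List ℕ → ℕ × List ℕ
  step r (cur , out) =
    let w = if proj₂ (proj₂ r) ∧ isRise a (proj₁ r) then 0 else 1 in
    if proj₁ (proj₂ r) ≡ᵇ 0 then (0 , (cur + w) ∷ out) else (cur + w , out)

compositions : ℕ → List (List ℕ)
compositions zero = [] ∷ []
compositions (suc n) = concatMap ext (compositions n)
  where
  ext : List ℕ → List (List ℕ)
  ext [] = (1 ∷ []) ∷ []
  ext (x ∷ xs) = (1 ∷ x ∷ xs) ∷ (suc x ∷ xs) ∷ []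

CatRise : List ℕ → ℕ → ℕ → Poly
CatRise α k ℓ = map (λ D → (dinvDec D , areaDec D))
  (filterᵇ (λ D → does (peakDec D ≟ k) ∧ does (≡-dec _≟_ (riseComp D) α))
    (decoratedPaths (sum α + ℓ)))

CatRisePred : List ℕ → ℕ → ℕ → Poly
CatRisePred α k zero = []
CatRisePred α k (suc ℓ) = CatRise α k ℓ

sumComps : ℕ → (List ℕ → Poly) → Poly
sumComps a f = concatMap f (compositions a)

-- Compare the coefficients of q^i t^j. A path counted on the left leaves the diagonal with a
-- double rise at row 0, followed by its first return 1 ∷ s₁ (the rows up to the next row of
-- height 0) and the rest r. Deleting row 0, lowering the first return by one and moving it behind
-- r is a bijection onto the decorated paths of size one less whose rise-touch composition is β
-- followed by the parts γ of the moved segment, where γ ⊨ a if row 0 is undecorated and γ ⊨ a + 1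
-- if row 0 is a decorated double rise (it then does not count towards the first part). Row 0 had
-- b-value ℓ(β), the number of returns in r; every other row keeps its b-value, its decoration and
-- its type, and the last maximal row stays the same row. Hence dinv∘ drops by ℓ(β), area∘ by a and
-- peak∘ is unchanged. For ℓ = 0 the parts already add up to the size, which rules out a decorated
-- double rise at row 0.

module Submission where

open import Defs
open import Data.Nat using (ℕ; zero; suc; _+_; _∸_; _⊔_; _≡ᵇ_; _<ᵇ_; _≟_; _≤_; _<_; _<?_; _⊓_; z≤n; s≤s; z<s; pred)
open import Data.Nat.Properties
open import Data.Bool using (Bool; true; false; _∧_; _∨_; not; if_then_else_; T; T?)
open import Data.List using (List; []; _∷_; _++_; map; concatMap; filterᵇ; length; foldr; zip; upTo; applyUpTo; take; drop; span)
open import Data.List.Properties using (++-assoc; length-++; map-++; ++-identityʳ; map-id; map-∘; length-map; length-take; length-drop; foldr-++; foldr-map; ≡-dec; ++-cancelˡ; ∷-injectiveˡ; ∷-injectiveʳ; concatMap-cong; take++drop≡id)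
open import Data.Nat.ListAction using (sum)
open import Data.Nat.ListAction.Properties using (sum-++)
open import Data.Maybe using (Maybe; just; nothing; _<∣>_; maybe′)
import Data.Maybe as Maybe
open import Data.Maybe.Properties using (<∣>-assoc; <∣>-identityʳ; map-<∣>; just-injective)
open import Data.Product using (_×_; _,_; proj₁; proj₂; Σ-syntax)
open import Data.Sum using (_⊎_; inj₁; inj₂)
open import Data.Empty using (⊥-elim)
open import Data.Unit using (⊤; tt)
open import Relation.Nullary using (Dec; does; yes; no; ¬_)
open import Relation.Nullary.Decidable using (dec-true; dec-false)
open import Relation.Binary.Definitions using (DecidableEquality)
open import Relation.Binary.PropositionalEquality
open import Function using (id; _∘_)
open import Data.Bool.Properties using (∨-identityʳ; T-≡) renaming (_≟_ to _≟ᴮ_)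
open import Data.Product.Properties using () renaming (≡-dec to ×-≡-dec)
open import Function.Bundles using (Equivalence)
open import Data.List.Membership.Propositional using (_∈_; find; lose)
open import Data.List.Membership.Propositional.Properties using (∈-map⁺; ∈-map⁻; ∈-upTo⁺; ∈-upTo⁻; ∈-concatMap⁺; ∈-concatMap⁻; ∈-filter⁺; ∈-filter⁻)
open import Data.List.Relation.Unary.Unique.Propositional.Properties using (++⁺; map⁺; filter⁺; upTo⁺)
open import Data.List.Relation.Unary.Any using (Any; here; there) renaming (map to Any-map)
open import Data.List.Relation.Unary.All using (All; []; _∷_; tabulate) renaming (map to All-map)
open import Data.List.Relation.Unary.Unique.Propositional using (Unique)
open import Data.List.Relation.Unary.All.Properties using (All¬⇒¬Any) renaming (++⁺ to All-++⁺; map⁺ to All-map⁺; ++⁻ʳ to All-++⁻ʳ)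
open import Data.List.Relation.Unary.AllPairs using ([]; _∷_)
open import Algebra.Properties.CommutativeSemigroup +-commutativeSemigroup using (interchange; x∙yz≈y∙xz; xy∙z≈y∙xz)
open import Data.Nat.Tactic.RingSolver using (solve-∀)

-- Weighted sums

∑ : {A : Set} → (A → ℕ) → List A → ℕ
∑ w xs = sum (map w xs)

𝟙 : Bool → ℕ
𝟙 b = if b then 1 else 0

δ : ℕ → ℕ → ℕ × ℕ → ℕ
δ i j m = 𝟙 ((proj₁ m ≡ᵇ i) ∧ (proj₂ m ≡ᵇ j))

∑-++ : {A : Set} (w : A → ℕ) (xs ys : List A) → ∑ w (xs ++ ys) ≡ ∑ w xs + ∑ w ys
∑-++ w xs ys = trans (cong sum (map-++ w xs ys)) (sum-++ (map w xs) (map w ys))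

∑-map : {A B : Set} (w : B → ℕ) (f : A → B) (xs : List A) → ∑ w (map f xs) ≡ ∑ (w ∘ f) xs
∑-map w f xs = cong sum (sym (map-∘ xs))

∑-cong-∈ : {A : Set} {w w' : A → ℕ} (xs : List A) → (∀ {z} → z ∈ xs → w z ≡ w' z) → ∑ w xs ≡ ∑ w' xs
∑-cong-∈ [] h = refl
∑-cong-∈ (x ∷ xs) h = cong₂ _+_ (h (here refl)) (∑-cong-∈ xs (h ∘ there))

∑-zero : {A : Set} {w : A → ℕ} (xs : List A) → (∀ {z} → z ∈ xs → w z ≡ 0) → ∑ w xs ≡ 0
∑-zero xs h = trans (∑-cong-∈ xs h) (∑-const-zero xs)
  where
  ∑-const-zero : ∀ {A : Set} (xs : List A) → ∑ (λ _ → 0) xs ≡ 0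
  ∑-const-zero [] = refl
  ∑-const-zero (x ∷ xs) = ∑-const-zero xs

∑-+ : {A : Set} (w w' : A → ℕ) (xs : List A) → ∑ (λ z → w z + w' z) xs ≡ ∑ w xs + ∑ w' xs
∑-+ w w' [] = refl
∑-+ w w' (x ∷ xs) = trans (cong (w x + w' x +_) (∑-+ w w' xs)) (interchange (w x) (w' x) _ _)

∑-filterᵇ : {A : Set} (w : A → ℕ) (p : A → Bool) (xs : List A) → ∑ w (filterᵇ p xs) ≡ ∑ (λ z → if p z then w z else 0) xs
∑-filterᵇ w p [] = refl
∑-filterᵇ w p (x ∷ xs) with p x
... | true = cong (w x +_) (∑-filterᵇ w p xs)
... | false = ∑-filterᵇ w p xs

length-filterᵇ : {A : Set} (p : A → Bool) (xs : List A) → length (filterᵇ p xs) ≡ ∑ (𝟙 ∘ p) xs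
length-filterᵇ p [] = refl
length-filterᵇ p (x ∷ xs) with p x
... | true = cong suc (length-filterᵇ p xs)
... | false = length-filterᵇ p xs

∑-concatMap : {A B : Set} (w : B → ℕ) (f : A → List B) (xs : List A) → ∑ w (concatMap f xs) ≡ ∑ (∑ w ∘ f) xs
∑-concatMap w f [] = refl
∑-concatMap w f (x ∷ xs) = trans (∑-++ w (f x) (concatMap f xs)) (cong (∑ w (f x) +_) (∑-concatMap w f xs))

∑-swap : {A B : Set} (w : A → B → ℕ) (xs : List A) (ys : List B) → ∑ (λ x → ∑ (w x) ys) xs ≡ ∑ (λ y → ∑ (λ x → w x y) xs) ys
∑-swap w [] ys = sym (∑-zero ys (λ _ → refl))
∑-swap w (x ∷ xs) ys = trans (cong (∑ (w x) ys +_) (∑-swap w xs ys)) (sym (∑-+ (w x) (λ y → ∑ (λ x → w x y) xs) ys))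

coeff≡∑δ : (P : Poly) (i j : ℕ) → coeff P i j ≡ ∑ (δ i j) P
coeff≡∑δ [] i j = refl
coeff≡∑δ ((x , y) ∷ P) i j = cong (δ i j (x , y) +_) (coeff≡∑δ P i j)

coeff-++ : (P Q : Poly) (i j : ℕ) → coeff (P ++ Q) i j ≡ coeff P i j + coeff Q i j
coeff-++ P Q i j = trans (coeff≡∑δ (P ++ Q) i j) (trans (∑-++ (δ i j) P Q) (sym (cong₂ _+_ (coeff≡∑δ P i j) (coeff≡∑δ Q i j))))

∑-pos⇒∃ : {A : Set} (w : A → ℕ) (xs : List A) → 0 < ∑ w xs → Σ[ x ∈ A ] x ∈ xs × 0 < w x
∑-pos⇒∃ w (x ∷ xs) pos with w x in eq
... | suc _ = x , here refl , subst (0 <_) (sym eq) z<s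
... | zero = let (y , y∈xs , wy>0) = ∑-pos⇒∃ w xs pos in y , there y∈xs , wy>0

∑-remove : {B : Set} (_≟_ : DecidableEquality B) (w : B → ℕ) {y : B} {ys : List B} → Unique ys → y ∈ ys →
  ∑ w ys ≡ w y + ∑ (λ z → if does (z ≟ y) then 0 else w z) ys
∑-remove _≟_ w {ys = z ∷ ys} (z∉ ∷ u) (here refl) with z ≟ z
... | no z≢z = ⊥-elim (z≢z refl)
... | yes _ = cong (w z +_) (∑-cong-∈ ys removed-is-absent)
  where
  removed-is-absent : ∀ {z'} → z' ∈ ys → w z' ≡ (if does (z' ≟ z) then 0 else w z')
  removed-is-absent {z'} z'∈ys with z' ≟ z
  ... | yes refl = ⊥-elim (All¬⇒¬Any z∉ z'∈ys)
  ... | no _ = refl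
∑-remove _≟_ w {y} {z ∷ ys} (z∉ ∷ u) (there y∈ys) with z ≟ y
... | yes refl = ⊥-elim (All¬⇒¬Any z∉ y∈ys)
... | no _ = trans (cong (w z +_) (∑-remove _≟_ w u y∈ys)) (x∙yz≈y∙xz (w z) (w y) _)

-- By induction on xs, deleting from ys the partner φ x of each term of positive weight.
∑-bijection : {A B : Set} (_≟_ : DecidableEquality B) (φ : A → B) (ψ : B → A) {xs : List A} {ys : List B} →
  Unique xs → Unique ys → (u : A → ℕ) (v : B → ℕ) →
  (∀ {x} → x ∈ xs → 0 < u x → φ x ∈ ys × v (φ x) ≡ u x × ψ (φ x) ≡ x) →
  (∀ {y} → y ∈ ys → 0 < v y → ψ y ∈ xs × u (ψ y) ≡ v y × φ (ψ y) ≡ y) →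
  ∑ u xs ≡ ∑ v ys
∑-bijection _≟_ φ ψ {[]} {ys} _ _ u v _ ψ-ok = sym (∑-zero ys v≡0)
  where
  v≡0 : ∀ {y} → y ∈ ys → v y ≡ 0
  v≡0 {y} y∈ys with v y in eq
  ... | zero = refl
  ... | suc _ with ψ-ok y∈ys (subst (0 <_) (sym eq) z<s)
  ... | () , _
∑-bijection _≟_ φ ψ {x ∷ xs} {ys} (x∉ ∷ uxs) uys u v φ-ok ψ-ok with u x in eq
... | zero = ∑-bijection _≟_ φ ψ uxs uys u v (φ-ok ∘ there) ψ-ok'
  where
  ψ-ok' : ∀ {y} → y ∈ ys → 0 < v y → ψ y ∈ xs × u (ψ y) ≡ v y × φ (ψ y) ≡ y
  ψ-ok' y∈ys pos with ψ-ok y∈ys pos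
  ... | here e , e₁ , _ = ⊥-elim (<-irrefl (sym (trans (trans (sym e₁) (cong u e)) eq)) pos)
  ... | there m , e₁ , e₂ = m , e₁ , e₂
... | suc m with φ-ok (here refl) (subst (0 <_) (sym eq) z<s)
... | φx∈ys , vφx≡ux , ψφx≡x = begin
    suc m + ∑ u xs    ≡⟨ cong (suc m +_) (∑-bijection _≟_ φ ψ uxs uys u v' φ-ok' ψ-ok') ⟩
    suc m + ∑ v' ys   ≡⟨ cong (_+ ∑ v' ys) (sym (trans vφx≡ux eq)) ⟩
    v (φ x) + ∑ v' ys ≡⟨ sym (∑-remove _≟_ v uys φx∈ys) ⟩
    ∑ v ys            ∎
  where
  open ≡-Reasoning
  v' : _ → ℕ
  v' z = if does (z ≟ φ x) then 0 else v z
  φ-ok' : ∀ {x'} → x' ∈ xs → 0 < u x' → φ x' ∈ ys × v' (φ x') ≡ u x' × ψ (φ x') ≡ x'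
  φ-ok' {x'} m pos with φ-ok (there m) pos
  ... | r₁ , r₂ , r₃ with φ x' ≟ φ x
  ... | yes e = ⊥-elim (All¬⇒¬Any x∉ (subst (_∈ xs) (trans (sym r₃) (trans (cong ψ e) ψφx≡x)) m))
  ... | no _ = r₁ , r₂ , r₃
  ψ-ok' : ∀ {y} → y ∈ ys → 0 < v' y → ψ y ∈ xs × u (ψ y) ≡ v' y × φ (ψ y) ≡ y
  ψ-ok' {y} m pos with y ≟ φ x
  ... | yes _ = ⊥-elim (<-irrefl refl pos)
  ... | no y≢φx with ψ-ok m pos
  ... | here e , _ , r₃ = ⊥-elim (y≢φx (trans (sym r₃) (cong φ e)))
  ... | there m' , r₂ , r₃ = m' , r₂ , r₃

∑-single : {A : Set} (w : A → ℕ) {xs : List A} {x₀ : A} → Unique xs → x₀ ∈ xs →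
  (∀ {x} → x ∈ xs → x ≢ x₀ → w x ≡ 0) → ∑ w xs ≡ w x₀
∑-single w {x ∷ xs} (x∉ ∷ u) (here refl) rest =
  trans (cong (w x +_) (∑-zero xs (λ m → rest (there m) (λ { refl → All¬⇒¬Any x∉ m })))) (+-identityʳ _)
∑-single w {x ∷ xs} (x∉ ∷ u) (there m) rest =
  trans (cong (_+ ∑ w xs) (rest (here refl) (λ { refl → All¬⇒¬Any x∉ m }))) (∑-single w u m (rest ∘ there))

concatMap⁺ : {A B : Set} {f : A → List B} (g : B → A) {xs : List A} → Unique xs →
  (∀ {x} → x ∈ xs → Unique (f x)) → (∀ {x z} → x ∈ xs → z ∈ f x → g z ≡ x) → Unique (concatMap f xs)
concatMap⁺ g {[]} [] _ _ = []
concatMap⁺ {f = f} g {x ∷ xs} (x∉ ∷ u) uf left-inv =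
  ++⁺ (uf (here refl)) (concatMap⁺ g u (uf ∘ there) (left-inv ∘ there)) disjoint
  where
  disjoint : ∀ {z} → ¬ (z ∈ f x × z ∈ concatMap f xs)
  disjoint (z∈fx , z∈rest) with find (∈-concatMap⁻ f z∈rest)
  ... | y , y∈xs , z∈fy = All¬⇒¬Any x∉ (subst (_∈ xs) (trans (sym (left-inv (there y∈xs) z∈fy)) (left-inv (here refl) z∈fx)) y∈xs)

-- The enumerated families

Positive : List ℕ → Set
Positive = All (0 <_)

IsAreaTail : ℕ → List ℕ → Set
IsAreaTail p [] = ⊤
IsAreaTail p (x ∷ xs) = x ≤ suc p × IsAreaTail x xs

StartsOnDiagonal : List ℕ → Set
StartsOnDiagonal [] = ⊤
StartsOnDiagonal (x ∷ _) = x ≡ 0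

IsDyck : List ℕ → Set
IsDyck a = StartsOnDiagonal a × IsAreaTail 0 a

∈-areaTail⁻ : ∀ p m {t} → t ∈ areaTail p m → length t ≡ m × IsAreaTail p t
∈-areaTail⁻ p zero (here refl) = refl , tt
∈-areaTail⁻ p (suc m) t∈ with find (∈-concatMap⁻ (λ x → map (x ∷_) (areaTail x m)) {upTo (suc (suc p))} t∈)
... | x , x∈ , t∈' with ∈-map⁻ (x ∷_) t∈'
... | t' , t'∈ , refl with ∈-areaTail⁻ x m t'∈
... | len , tail = cong suc len , ≤-pred (∈-upTo⁻ x∈) , tail

∈-areaTail⁺ : ∀ p {t} → IsAreaTail p t → t ∈ areaTail p (length t)
∈-areaTail⁺ p {[]} _ = here refl
∈-areaTail⁺ p {x ∷ t} (x≤ , tail) =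
  ∈-concatMap⁺ (λ x → map (x ∷_) (areaTail x (length t))) (lose (∈-upTo⁺ (s≤s x≤)) (∈-map⁺ (x ∷_) (∈-areaTail⁺ x tail)))

head : List ℕ → ℕ
head [] = 0
head (x ∷ _) = x

areaTail-unique : ∀ p m → Unique (areaTail p m)
areaTail-unique p zero = [] ∷ []
areaTail-unique p (suc m) = concatMap⁺ head (upTo⁺ (suc (suc p)))
  (λ {x} _ → map⁺ ∷-injectiveʳ (areaTail-unique x m))
  (λ {x} _ z∈ → let (_ , _ , e) = ∈-map⁻ (x ∷_) z∈ in cong head e)

∈-dyckPaths⁻ : ∀ n {a} → a ∈ dyckPaths n → length a ≡ n × IsDyck a
∈-dyckPaths⁻ zero (here refl) = refl , tt , tt
∈-dyckPaths⁻ (suc n) a∈ with ∈-map⁻ (0 ∷_) a∈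
... | t , t∈ , refl = let (len , tail) = ∈-areaTail⁻ 0 n t∈ in cong suc len , refl , z≤n , tail

∈-dyckPaths⁺ : ∀ {a} → IsDyck a → a ∈ dyckPaths (length a)
∈-dyckPaths⁺ {[]} _ = here refl
∈-dyckPaths⁺ {.0 ∷ t} (refl , _ , tail) = ∈-map⁺ (0 ∷_) (∈-areaTail⁺ 0 tail)

dyckPaths-unique : ∀ n → Unique (dyckPaths n)
dyckPaths-unique zero = [] ∷ []
dyckPaths-unique (suc n) = map⁺ {f = 0 ∷_} ∷-injectiveʳ (areaTail-unique 0 n)

∈-allBools⁻ : ∀ n {d} → d ∈ allBools n → length d ≡ n
∈-allBools⁻ zero (here refl) = refl
∈-allBools⁻ (suc n) d∈ with find (∈-concatMap⁻ (λ d → (false ∷ d) ∷ (true ∷ d) ∷ []) {allBools n} d∈)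
... | d' , d'∈ , here refl = cong suc (∈-allBools⁻ n d'∈)
... | d' , d'∈ , there (here refl) = cong suc (∈-allBools⁻ n d'∈)

∈-allBools⁺ : ∀ d → d ∈ allBools (length d)
∈-allBools⁺ [] = here refl
∈-allBools⁺ (b ∷ d) = ∈-concatMap⁺ (λ d → (false ∷ d) ∷ (true ∷ d) ∷ []) (lose (∈-allBools⁺ d) (choice b))
  where
  choice : ∀ b → (b ∷ d) ∈ (false ∷ d) ∷ (true ∷ d) ∷ []
  choice false = here refl
  choice true = there (here refl)

allBools-unique : ∀ n → Unique (allBools n)
allBools-unique zero = [] ∷ []
allBools-unique (suc n) = concatMap⁺ (drop 1) (allBools-unique n)
  (λ _ → ((λ ()) ∷ []) ∷ [] ∷ [])
  (λ { _ (here refl) → refl ; _ (there (here refl)) → refl })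

topRowUndecorated : List ℕ → List Bool → Bool
topRowUndecorated a d = not (getB d (lastMaxIndex a))

∈-decoratedPaths⁻ : ∀ n {a d} → (a , d) ∈ decoratedPaths n →
  length a ≡ n × IsDyck a × length d ≡ n × T (topRowUndecorated a d)
∈-decoratedPaths⁻ n {a} D∈ with find (∈-concatMap⁻ (λ a → map (a ,_) (filterᵇ (topRowUndecorated a) (allBools n))) {dyckPaths n} D∈)
... | a' , a'∈ , D∈' with ∈-map⁻ (a' ,_) D∈'
... | d' , d'∈ , refl =
  let (len-a , dyck) = ∈-dyckPaths⁻ n a'∈
      (d∈ , top) = ∈-filter⁻ (T? ∘ topRowUndecorated a') d'∈
  in len-a , dyck , ∈-allBools⁻ n d∈ , top

∈-decoratedPaths⁺ : ∀ {a d} → IsDyck a → length d ≡ length a → T (topRowUndecorated a d) →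
  (a , d) ∈ decoratedPaths (length a)
∈-decoratedPaths⁺ {a} {d} dyck len top =
  ∈-concatMap⁺ (λ a' → map (a' ,_) (filterᵇ (topRowUndecorated a') (allBools (length a)))) (lose (∈-dyckPaths⁺ dyck)
    (∈-map⁺ (a ,_) (∈-filter⁺ (T? ∘ topRowUndecorated a) (subst (λ n → d ∈ allBools n) len (∈-allBools⁺ d)) top)))

decoratedPaths-unique : ∀ n → Unique (decoratedPaths n)
decoratedPaths-unique n = concatMap⁺ proj₁ (dyckPaths-unique n)
  (λ {a} _ → map⁺ {f = a ,_} (λ { refl → refl }) (filter⁺ (T? ∘ topRowUndecorated a) (allBools-unique n)))
  (λ {a} _ D∈ → let (_ , _ , e) = ∈-map⁻ (a ,_) D∈ in cong proj₁ e)

extendComposition : List ℕ → List (List ℕ)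
extendComposition [] = (1 ∷ []) ∷ []
extendComposition (x ∷ xs) = (1 ∷ x ∷ xs) ∷ (suc x ∷ xs) ∷ []

compositions-suc : ∀ n → compositions (suc n) ≡ concatMap extendComposition (compositions n)
compositions-suc n = concatMap-cong (λ { [] → refl ; (x ∷ xs) → refl }) (compositions n)

∈-compositions⁻ : ∀ n {γ} → γ ∈ compositions n → sum γ ≡ n × Positive γ
∈-compositions⁻ zero (here refl) = refl , []
∈-compositions⁻ (suc n) γ∈ with find (∈-concatMap⁻ extendComposition {compositions n} (subst (_ ∈_) (compositions-suc n) γ∈))
... | [] , γ'∈ , here refl = cong suc (proj₁ (∈-compositions⁻ n γ'∈)) , z<s ∷ []
... | x ∷ xs , γ'∈ , here refl = let (total , pos) = ∈-compositions⁻ n γ'∈ in cong suc total , z<s ∷ pos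
... | x ∷ xs , γ'∈ , there (here refl) with ∈-compositions⁻ n γ'∈
... | total , _ ∷ pos = cong suc total , z<s ∷ pos

∈-compositions-extend : ∀ n {γ γ'} → γ' ∈ compositions n → γ ∈ extendComposition γ' → γ ∈ compositions (suc n)
∈-compositions-extend n γ'∈ γ∈ = subst (_ ∈_) (sym (compositions-suc n)) (∈-concatMap⁺ extendComposition (lose γ'∈ γ∈))

∈-compositions⁺ : ∀ n {γ} → Positive γ → sum γ ≡ n → γ ∈ compositions n
∈-compositions⁺ zero {[]} _ _ = here refl
∈-compositions⁺ zero {suc _ ∷ _} (_ ∷ _) ()
∈-compositions⁺ (suc n) {suc zero ∷ γ} (_ ∷ pos) total =
  ∈-compositions-extend n (∈-compositions⁺ n pos (suc-injective total)) (starts γ)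
  where
  starts : ∀ γ → (1 ∷ γ) ∈ extendComposition γ
  starts [] = here refl
  starts (_ ∷ _) = here refl
∈-compositions⁺ (suc n) {suc (suc x) ∷ γ} (_ ∷ pos) total =
  ∈-compositions-extend n (∈-compositions⁺ n (z<s ∷ pos) (suc-injective total)) (there (here refl))

compositions-unique : ∀ n → Unique (compositions n)
compositions-unique zero = [] ∷ []
compositions-unique (suc n) = subst Unique (sym (compositions-suc n))
  (concatMap⁺ shrink (compositions-unique n) extensions-unique shrink-extend)
  where
  shrink : List ℕ → List ℕ
  shrink [] = []
  shrink (zero ∷ xs) = xs
  shrink (suc zero ∷ xs) = xs
  shrink (suc (suc x) ∷ xs) = suc x ∷ xs
  extensions-unique : ∀ {γ} → γ ∈ compositions n → Unique (extendComposition γ)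
  extensions-unique {[]} _ = [] ∷ []
  extensions-unique {x ∷ xs} _ = ((λ e → 1+n≢n (suc-injective (cong length e))) ∷ []) ∷ [] ∷ []
  shrink-extend : ∀ {γ z} → γ ∈ compositions n → z ∈ extendComposition γ → shrink z ≡ γ
  shrink-extend {[]} _ (here refl) = refl
  shrink-extend {x ∷ xs} _ (here refl) = refl
  shrink-extend {x ∷ xs} γ∈ (there (here refl)) with ∈-compositions⁻ n γ∈
  ... | _ , s≤s z≤n ∷ _ = refl

compositions-nonempty : ∀ {n γ} → 1 ≤ n → γ ∈ compositions n → γ ≢ []
compositions-nonempty 1≤n γ∈ refl = <⇒≢ 1≤n (proj₁ (∈-compositions⁻ _ γ∈))

-- Rows of a decorated path

occ : ℕ → List ℕ → ℕ
occ x [] = 0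
occ x (y ∷ ys) = 𝟙 (y ≡ᵇ x) + occ x ys

occ-++ : ∀ x xs ys → occ x (xs ++ ys) ≡ occ x xs + occ x ys
occ-++ x [] ys = refl
occ-++ x (y ∷ xs) ys = trans (cong (𝟙 (y ≡ᵇ x) +_) (occ-++ x xs ys)) (sym (+-assoc (𝟙 (y ≡ᵇ x)) _ _))

nextIsRise : ℕ → List ℕ → Bool
nextIsRise x [] = false
nextIsRise x (y ∷ _) = y ≡ᵇ suc x

mapWithContext : {B : Set} → (List ℕ → ℕ → List ℕ → B) → List ℕ → List ℕ → List B
mapWithContext f pre [] = []
mapWithContext f pre (x ∷ post) = f pre x post ∷ mapWithContext f (pre ++ x ∷ []) post

-- Whether a row of height x between the rows pre and post is a double rise, and its b-value.
rowData : List ℕ → ℕ → List ℕ → Bool × ℕ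
rowData pre x post = (nextIsRise x post , occ x post + occ (suc x) pre)

allRowData : List ℕ → List (Bool × ℕ)
allRowData a = mapWithContext rowData [] a

Row : Set
Row = (ℕ × Bool) × (Bool × ℕ)

height : Row → ℕ
height r = proj₁ (proj₁ r)

decorated : Row → Bool
decorated r = proj₂ (proj₁ r)

doubleRise : Row → Bool
doubleRise r = proj₁ (proj₂ r)

bValue : Row → ℕ
bValue r = proj₂ (proj₂ r)

rows : DecPath → List Row
rows (a , d) = zip (zip a d) (allRowData a)

enumerateFrom : {A : Set} → ℕ → List A → List (ℕ × A)
enumerateFrom k [] = []
enumerateFrom k (y ∷ ys) = (k , y) ∷ enumerateFrom (suc k) ys

zip-applyUpTo : {A : Set} (f : ℕ → ℕ) (k : ℕ) (ys : List A) → (∀ i → f i ≡ k + i) →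
  zip (applyUpTo f (length ys)) ys ≡ enumerateFrom k ys
zip-applyUpTo f k [] h = refl
zip-applyUpTo f k (y ∷ ys) h = cong₂ _∷_ (cong (_, y) (trans (h 0) (+-identityʳ k)))
  (zip-applyUpTo (f ∘ suc) (suc k) ys (λ i → trans (h (suc i)) (+-suc k i)))

indexed≡enumerateFrom0 : {A : Set} (ys : List A) → zip (upTo (length ys)) ys ≡ enumerateFrom 0 ys
indexed≡enumerateFrom0 ys = zip-applyUpTo id 0 ys (λ i → refl)

enumerateFrom-++ : {A : Set} (k : ℕ) (xs ys : List A) →
  enumerateFrom k (xs ++ ys) ≡ enumerateFrom k xs ++ enumerateFrom (k + length xs) ys
enumerateFrom-++ k [] ys = cong (λ m → enumerateFrom m ys) (sym (+-identityʳ k))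
enumerateFrom-++ k (x ∷ xs) ys = cong ((k , x) ∷_) (trans (enumerateFrom-++ (suc k) xs ys)
  (cong (λ m → enumerateFrom (suc k) xs ++ enumerateFrom m ys) (sym (+-suc k (length xs)))))

getHead : List ℕ → Maybe ℕ
getHead [] = nothing
getHead (y ∷ _) = just y

get-middle : ∀ pre x post → get (pre ++ x ∷ post) (length pre) ≡ just x
get-middle [] x post = refl
get-middle (_ ∷ pre) x post = get-middle pre x post

get-after-middle : ∀ pre x post → get (pre ++ x ∷ post) (suc (length pre)) ≡ getHead post
get-after-middle [] x [] = refl
get-after-middle [] x (y ∷ post) = refl
get-after-middle (_ ∷ pre) x post = get-after-middle pre x post

isRise-middle : ∀ pre x post → isRise (pre ++ x ∷ post) (length pre) ≡ nextIsRise x post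
isRise-middle pre x post rewrite get-middle pre x post | get-after-middle pre x post with post
... | [] = refl
... | _ ∷ _ = refl

<ᵇ-true : ∀ {m n} → m < n → (m <ᵇ n) ≡ true
<ᵇ-true {zero} {suc n} _ = refl
<ᵇ-true {suc m} {suc n} (s≤s m<n) = <ᵇ-true m<n

<ᵇ-false : ∀ {m n} → n ≤ m → (m <ᵇ n) ≡ false
<ᵇ-false {m} {zero} _ = refl
<ᵇ-false {suc m} {suc n} (s≤s n≤m) = <ᵇ-false n≤m

bCounts : ℕ → ℕ → ℕ × ℕ → Bool
bCounts i x p = ((i <ᵇ proj₁ p) ∧ (proj₂ p ≡ᵇ x)) ∨ ((proj₁ p <ᵇ i) ∧ (proj₂ p ≡ᵇ suc x))

bCounts-before : ∀ i x k pre → k + length pre ≤ i → ∑ (𝟙 ∘ bCounts i x) (enumerateFrom k pre) ≡ occ (suc x) pre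
bCounts-before i x k [] _ = refl
bCounts-before i x k (y ∷ pre) k+len≤i with subst (_≤ i) (+-suc k (length pre)) k+len≤i
... | k+len<i rewrite <ᵇ-false (<⇒≤ (m+n≤o⇒m≤o (suc k) k+len<i)) | <ᵇ-true (m+n≤o⇒m≤o (suc k) k+len<i) =
  cong (𝟙 (y ≡ᵇ suc x) +_) (bCounts-before i x (suc k) pre k+len<i)

bCounts-after : ∀ i x k post → i < k → ∑ (𝟙 ∘ bCounts i x) (enumerateFrom k post) ≡ occ x post
bCounts-after i x k [] _ = refl
bCounts-after i x k (y ∷ post) i<k rewrite <ᵇ-true i<k | <ᵇ-false (≤-trans (n≤1+n i) i<k) | ∨-identityʳ (y ≡ᵇ x) =
  cong (𝟙 (y ≡ᵇ x) +_) (bCounts-after i x (suc k) post (≤-trans i<k (n≤1+n k)))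

bStat-middle : ∀ pre x post → bStat (pre ++ x ∷ post) (length pre) x ≡ occ x post + occ (suc x) pre
bStat-middle pre x post = begin
    bStat (pre ++ x ∷ post) i x
  ≡⟨ length-filterᵇ (bCounts i x) (indexed (pre ++ x ∷ post)) ⟩
    ∑ (𝟙 ∘ bCounts i x) (indexed (pre ++ x ∷ post))
  ≡⟨ cong (∑ (𝟙 ∘ bCounts i x)) (trans (indexed≡enumerateFrom0 (pre ++ x ∷ post)) (enumerateFrom-++ 0 pre (x ∷ post))) ⟩
    ∑ (𝟙 ∘ bCounts i x) (enumerateFrom 0 pre ++ enumerateFrom i (x ∷ post))
  ≡⟨ ∑-++ _ (enumerateFrom 0 pre) _ ⟩
    ∑ (𝟙 ∘ bCounts i x) (enumerateFrom 0 pre) + ∑ (𝟙 ∘ bCounts i x) (enumerateFrom i (x ∷ post))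
  ≡⟨ cong₂ _+_ (bCounts-before i x 0 pre ≤-refl) own-row-excluded ⟩
    occ (suc x) pre + occ x post
  ≡⟨ +-comm (occ (suc x) pre) _ ⟩
    occ x post + occ (suc x) pre ∎
  where
  open ≡-Reasoning
  i = length pre
  own-row-excluded : ∑ (𝟙 ∘ bCounts i x) (enumerateFrom i (x ∷ post)) ≡ occ x post
  own-row-excluded rewrite <ᵇ-false (≤-refl {i}) = bCounts-after i x (suc i) post ≤-refl

-- Defs computes isRise and bStat through global row indices; they only depend on the context of the row.
withRowData : {Y : Set} (π : Y → ℕ) (a : List ℕ) → ℕ × Y → Y × (Bool × ℕ)
withRowData π a r = (proj₂ r , (isRise a (proj₁ r) , bStat a (proj₁ r) (π (proj₂ r))))

withRowData-from : {Y : Set} (π : Y → ℕ) (pre post : List ℕ) (ys : List Y) → map π ys ≡ post →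
  map (withRowData π (pre ++ post)) (enumerateFrom (length pre) ys) ≡ zip ys (mapWithContext rowData pre post)
withRowData-from π pre [] [] _ = refl
withRowData-from π pre (_ ∷ post) (y ∷ ys) e with ∷-injectiveˡ e | ∷-injectiveʳ e
... | refl | e' = cong₂ _∷_ (cong (y ,_) (cong₂ _,_ (isRise-middle pre (π y) post) (bStat-middle pre (π y) post)))
  (subst₂ (λ a k → map (withRowData π a) (enumerateFrom k ys) ≡ zip ys (mapWithContext rowData (pre ++ π y ∷ []) post))
    (++-assoc pre (π y ∷ []) post) (trans (length-++ pre) (+-comm (length pre) 1))
    (withRowData-from π (pre ++ π y ∷ []) post ys e'))

withRowData-all : {Y : Set} (π : Y → ℕ) (ys : List Y) (a : List ℕ) → map π ys ≡ a →
  map (withRowData π a) (enumerateFrom 0 ys) ≡ zip ys (allRowData a)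
withRowData-all π ys a e = withRowData-from π [] a ys e

length-zip : {A B : Set} (xs : List A) (ys : List B) → length ys ≡ length xs → length (zip xs ys) ≡ length xs
length-zip [] ys e = refl
length-zip (x ∷ xs) (y ∷ ys) e = cong suc (length-zip xs ys (suc-injective e))

map-proj₁-zip : {A B : Set} (xs : List A) (ys : List B) → length ys ≡ length xs → map proj₁ (zip xs ys) ≡ xs
map-proj₁-zip [] ys e = refl
map-proj₁-zip (x ∷ xs) (y ∷ ys) e = cong (x ∷_) (map-proj₁-zip xs ys (suc-injective e))

rowsOf≡rows : ∀ a d → length d ≡ length a → map (withRowData proj₁ a) (rowsOf (a , d)) ≡ rows (a , d)
rowsOf≡rows a d e = trans
  (cong (map (withRowData proj₁ a)) (trans (cong (λ n → zip (upTo n) (zip a d)) (sym (length-zip a d e))) (indexed≡enumerateFrom0 (zip a d))))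
  (withRowData-all proj₁ (zip a d) a (map-proj₁-zip a d e))

-- A row's contributions to Σ_{Rise∘} a_{i+1}, Σ_{Peak∘} b_i, peak∘, |Rise∘| and to its part of α^Rise.
riseLoss peakLoss decoratedPeak decoratedRise partWeight : Row → ℕ
riseLoss r = if decorated r ∧ doubleRise r then suc (height r) else 0
peakLoss r = if decorated r ∧ not (doubleRise r) then bValue r else 0
decoratedPeak r = 𝟙 (decorated r ∧ not (doubleRise r))
decoratedRise r = 𝟙 (decorated r ∧ doubleRise r)
partWeight r = if decorated r ∧ doubleRise r then 0 else 1

∑-rowsOf : ∀ a d (w : Row → ℕ) → length d ≡ length a → ∑ (w ∘ withRowData proj₁ a) (rowsOf (a , d)) ≡ ∑ w (rows (a , d))
∑-rowsOf a d w e = trans (sym (∑-map w (withRowData proj₁ a) (rowsOf (a , d)))) (cong (∑ w) (rowsOf≡rows a d e))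

riseDecSum≡∑rows : ∀ a d → length d ≡ length a → riseDecSum (a , d) ≡ ∑ riseLoss (rows (a , d))
riseDecSum≡∑rows a d = ∑-rowsOf a d riseLoss

peakDecSum≡∑rows : ∀ a d → length d ≡ length a → peakDecSum (a , d) ≡ ∑ peakLoss (rows (a , d))
peakDecSum≡∑rows a d = ∑-rowsOf a d peakLoss

peakDec≡∑rows : ∀ a d → length d ≡ length a → peakDec (a , d) ≡ ∑ decoratedPeak (rows (a , d))
peakDec≡∑rows a d e = trans (length-filterᵇ _ (rowsOf (a , d))) (∑-rowsOf a d decoratedPeak e)

length-mapWithContext : {B : Set} (f : List ℕ → ℕ → List ℕ → B) (pre post : List ℕ) → length (mapWithContext f pre post) ≡ length post
length-mapWithContext f pre [] = refl
length-mapWithContext f pre (x ∷ post) = cong suc (length-mapWithContext f _ post)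

dinv≡∑rowData : ∀ a → dinv a ≡ ∑ proj₂ (allRowData a)
dinv≡∑rowData a = begin
    dinv a
  ≡⟨ cong (∑ _) (indexed≡enumerateFrom0 a) ⟩
    ∑ (proj₂ ∘ proj₂ ∘ withRowData id a) (enumerateFrom 0 a)
  ≡⟨ sym (∑-map (proj₂ ∘ proj₂) (withRowData id a) (enumerateFrom 0 a)) ⟩
    ∑ (proj₂ ∘ proj₂) (map (withRowData id a) (enumerateFrom 0 a))
  ≡⟨ cong (∑ (proj₂ ∘ proj₂)) (withRowData-all id a a (map-id a)) ⟩
    ∑ (proj₂ ∘ proj₂) (zip a (allRowData a))
  ≡⟨ ∑-zip a (allRowData a) (length-mapWithContext rowData [] a) ⟩
    ∑ proj₂ (allRowData a) ∎
  where
  open ≡-Reasoning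
  ∑-zip : (xs : List ℕ) (gs : List (Bool × ℕ)) → length gs ≡ length xs → ∑ (proj₂ ∘ proj₂) (zip xs gs) ≡ ∑ proj₂ gs
  ∑-zip [] [] e = refl
  ∑-zip (x ∷ xs) (g ∷ gs) e = cong (proj₂ g +_) (∑-zip xs gs (suc-injective e))

compositionStep : Row → ℕ × List ℕ → ℕ × List ℕ
compositionStep r (cur , out) =
  if height r ≡ᵇ 0 then (0 , (cur + partWeight r) ∷ out) else (cur + partWeight r , out)

compositionOf : List Row → List ℕ
compositionOf rs = proj₂ (foldr compositionStep (0 , []) rs)

riseComp≡compositionOf : ∀ a d → length d ≡ length a → riseComp (a , d) ≡ compositionOf (rows (a , d))
riseComp≡compositionOf a d e = cong proj₂ (trans
  (sym (foldr-map compositionStep (withRowData proj₁ a) (0 , []) (rowsOf (a , d))))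
  (cong (foldr compositionStep (0 , [])) (rowsOf≡rows a d e)))

onDiagonal : Row → ℕ
onDiagonal r = 𝟙 (height r ≡ᵇ 0)

foldr-compositionStep-++ : ∀ c out rs → foldr compositionStep (c , out) rs ≡
  (proj₁ (foldr compositionStep (c , []) rs) , proj₂ (foldr compositionStep (c , []) rs) ++ out)
foldr-compositionStep-++ c out [] = refl
foldr-compositionStep-++ c out (r ∷ rs) rewrite foldr-compositionStep-++ c out rs with height r ≡ᵇ 0
... | true = refl
... | false = refl

foldr-compositionStep-above : ∀ c out rs → All (λ r → 0 < height r) rs →
  foldr compositionStep (c , out) rs ≡ (c + ∑ partWeight rs , out)
foldr-compositionStep-above c out [] _ = cong (_, out) (sym (+-identityʳ c))
foldr-compositionStep-above c out (r@((suc _ , _) , _) ∷ rs) (_ ∷ above) rewrite foldr-compositionStep-above c out rs above =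
  cong (_, out) (trans (+-assoc c (∑ partWeight rs) _) (cong (c +_) (+-comm (∑ partWeight rs) (partWeight r))))

compositionOf-sum : ∀ rs → proj₁ (foldr compositionStep (0 , []) rs) + sum (compositionOf rs) ≡ ∑ partWeight rs
compositionOf-sum [] = refl
compositionOf-sum (r ∷ rs) with foldr compositionStep (0 , []) rs | compositionOf-sum rs | height r ≡ᵇ 0
... | (c , out) | ih | true = trans (xy∙z≈y∙xz c (partWeight r) (sum out)) (cong (partWeight r +_) ih)
... | (c , out) | ih | false = trans (xy∙z≈y∙xz c (partWeight r) (sum out)) (cong (partWeight r +_) ih)

length-compositionOf : ∀ rs → length (compositionOf rs) ≡ ∑ onDiagonal rs
length-compositionOf [] = refl
length-compositionOf (r ∷ rs) with foldr compositionStep (0 , []) rs | length-compositionOf rs | height r ≡ᵇ 0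
... | (c , out) | ih | true = cong suc ih
... | (c , out) | ih | false = ih

-- The running count is positive whenever the rows to come start above the diagonal:
-- the row just before the next return (or the end) is a peak and counts 1.
compositionOf-positive-from : ∀ pre post (d : List Bool) → length d ≡ length post →
  let rs = zip (zip post d) (mapWithContext rowData pre post) in
  Positive (compositionOf rs) × (∀ {x q} → post ≡ suc x ∷ q → 0 < proj₁ (foldr compositionStep (0 , []) rs))
compositionOf-positive-from pre [] [] _ = [] , λ ()
compositionOf-positive-from pre (x ∷ post) (b ∷ d) e
  with foldr compositionStep (0 , []) (zip (zip post d) (mapWithContext rowData (pre ++ x ∷ []) post))
     | compositionOf-positive-from (pre ++ x ∷ []) post d (suc-injective e)
... | (c , out) | pos , running = step x (running-count b post running)
  where
  running-count : ∀ b post → (∀ {y q} → post ≡ suc y ∷ q → 0 < c) → 0 < c + partWeight ((x , b) , rowData pre x post)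
  running-count false post _ = subst (0 <_) (+-comm 1 c) z<s
  running-count true [] _ = subst (0 <_) (+-comm 1 c) z<s
  running-count true (zero ∷ q) _ = subst (0 <_) (+-comm 1 c) z<s
  running-count true (suc y ∷ q) h with y ≡ᵇ x
  ... | true = subst (0 <_) (sym (+-identityʳ c)) (h refl)
  ... | false = subst (0 <_) (+-comm 1 c) z<s
  step : ∀ x → 0 < c + partWeight ((x , b) , rowData pre x post) →
    let r = ((x , b) , rowData pre x post) in
    Positive (proj₂ (compositionStep r (c , out))) × (∀ {x' q} → x ∷ post ≡ suc x' ∷ q → 0 < proj₁ (compositionStep r (c , out)))
  step zero c+w>0 = c+w>0 ∷ pos , λ ()
  step (suc _) c+w>0 = pos , λ _ → c+w>0

compositionOf-positive : ∀ a d → length d ≡ length a → Positive (compositionOf (rows (a , d)))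
compositionOf-positive a d e = proj₁ (compositionOf-positive-from [] a d e)

compositionOf-running-fromDiagonal : ∀ xs (ds : List Bool) (gs : List (Bool × ℕ)) → StartsOnDiagonal xs →
  proj₁ (foldr compositionStep (0 , []) (zip (zip xs ds) gs)) ≡ 0
compositionOf-running-fromDiagonal [] ds gs _ = refl
compositionOf-running-fromDiagonal (x ∷ xs) [] gs _ = refl
compositionOf-running-fromDiagonal (x ∷ xs) (b ∷ ds) [] _ = refl
compositionOf-running-fromDiagonal (.0 ∷ xs) (b ∷ ds) (g ∷ gs) refl = refl

zip-above : ∀ xs (ds : List Bool) (gs : List (Bool × ℕ)) → Positive xs → All (λ r → 0 < height r) (zip (zip xs ds) gs)
zip-above [] ds gs _ = []
zip-above (x ∷ xs) [] gs _ = []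
zip-above (x ∷ xs) (b ∷ ds) [] _ = []
zip-above (x ∷ xs) (b ∷ ds) (g ∷ gs) (x>0 ∷ pos) = x>0 ∷ zip-above xs ds gs pos

∑-onDiagonal : ∀ xs (ds : List Bool) (gs : List (Bool × ℕ)) → length ds ≡ length xs → length gs ≡ length xs →
  ∑ onDiagonal (zip (zip xs ds) gs) ≡ occ 0 xs
∑-onDiagonal [] ds gs _ _ = refl
∑-onDiagonal (x ∷ xs) (b ∷ ds) (g ∷ gs) e₁ e₂ = cong (𝟙 (x ≡ᵇ 0) +_) (∑-onDiagonal xs ds gs (suc-injective e₁) (suc-injective e₂))

∑partWeight+∑decoratedRise : ∀ rs → ∑ partWeight rs + ∑ decoratedRise rs ≡ length rs
∑partWeight+∑decoratedRise [] = refl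
∑partWeight+∑decoratedRise (r ∷ rs) with decorated r ∧ doubleRise r
... | true = trans (+-suc (∑ partWeight rs) (∑ decoratedRise rs)) (cong suc (∑partWeight+∑decoratedRise rs))
... | false = cong suc (∑partWeight+∑decoratedRise rs)

length-riseComp : ∀ a d → length d ≡ length a → length (riseComp (a , d)) ≡ occ 0 a
length-riseComp a d e = trans (cong length (riseComp≡compositionOf a d e))
  (trans (length-compositionOf (rows (a , d))) (∑-onDiagonal a d (allRowData a) e (length-mapWithContext rowData [] a)))

sum-riseComp : ∀ a d → length d ≡ length a → StartsOnDiagonal a →
  sum (riseComp (a , d)) + ∑ decoratedRise (rows (a , d)) ≡ length a
sum-riseComp a d len a₀ = begin
    sum (riseComp (a , d)) + ∑ decoratedRise (rows (a , d))
  ≡⟨ cong (λ c → c + ∑ decoratedRise (rows (a , d))) (begin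
       sum (riseComp (a , d))
     ≡⟨ cong sum (riseComp≡compositionOf a d len) ⟩
       sum (compositionOf (rows (a , d)))
     ≡⟨ cong (_+ sum (compositionOf (rows (a , d)))) (sym (compositionOf-running-fromDiagonal a d (allRowData a) a₀)) ⟩
       proj₁ (foldr compositionStep (0 , []) (rows (a , d))) + sum (compositionOf (rows (a , d)))
     ≡⟨ compositionOf-sum (rows (a , d)) ⟩
       ∑ partWeight (rows (a , d)) ∎) ⟩
    ∑ partWeight (rows (a , d)) + ∑ decoratedRise (rows (a , d))
  ≡⟨ ∑partWeight+∑decoratedRise (rows (a , d)) ⟩
    length (rows (a , d))
  ≡⟨ trans (length-zip (zip a d) (allRowData a) (trans (length-mapWithContext rowData [] a) (sym (length-zip a d len)))) (length-zip a d len) ⟩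
    length a ∎
  where open ≡-Reasoning

-- areaDec and dinvDec subtract with truncation; these bounds make the subtraction exact.
∑riseLoss≤sum-from : ∀ pre xs (ds : List Bool) → ∑ riseLoss (zip (zip xs ds) (mapWithContext rowData pre xs)) ≤ sum (drop 1 xs)
∑riseLoss≤sum-from pre [] ds = z≤n
∑riseLoss≤sum-from pre (x ∷ q) [] = z≤n
∑riseLoss≤sum-from pre (x ∷ q) (b ∷ ds) =
  ≤-trans (+-mono-≤ (own-row b q) (∑riseLoss≤sum-from (pre ++ x ∷ []) q ds)) (≤-reflexive (sym (sum-head q)))
  where
  own-row : ∀ b q → riseLoss ((x , b) , rowData pre x q) ≤ head q
  own-row false q = z≤n
  own-row true [] = z≤n
  own-row true (y ∷ q) with y ≡ᵇ suc x in eq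
  ... | true = ≤-reflexive (sym (≡ᵇ⇒≡ y (suc x) (Equivalence.from T-≡ eq)))
  ... | false = z≤n
  sum-head : ∀ q → sum q ≡ head q + sum (drop 1 q)
  sum-head [] = refl
  sum-head (_ ∷ _) = refl

∑riseLoss≤area : ∀ a d → ∑ riseLoss (rows (a , d)) ≤ area a
∑riseLoss≤area [] d = z≤n
∑riseLoss≤area (x ∷ q) d = ≤-trans (∑riseLoss≤sum-from [] (x ∷ q) d) (m≤n+m (sum q) x)

∑peakLoss≤∑b : ∀ xs (ds : List Bool) gs → ∑ peakLoss (zip (zip xs ds) gs) ≤ ∑ proj₂ gs
∑peakLoss≤∑b [] ds gs = z≤n
∑peakLoss≤∑b (x ∷ xs) [] gs = z≤n
∑peakLoss≤∑b (x ∷ xs) (b ∷ ds) [] = z≤n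
∑peakLoss≤∑b (x ∷ xs) (b ∷ ds) ((ρ , v) ∷ gs) = +-mono-≤ (own-row (b ∧ not ρ)) (∑peakLoss≤∑b xs ds gs)
  where
  own-row : ∀ c → (if c then v else 0) ≤ v
  own-row true = ≤-refl
  own-row false = z≤n

-- The row of maximal height

maxEntry-++ : ∀ xs ys → maxEntry (xs ++ ys) ≡ maxEntry xs ⊔ maxEntry ys
maxEntry-++ [] ys = refl
maxEntry-++ (x ∷ xs) ys = trans (cong (x ⊔_) (maxEntry-++ xs ys)) (sym (⊔-assoc x _ _))

maxEntry-map-pred : ∀ xs → maxEntry (map pred xs) ≡ pred (maxEntry xs)
maxEntry-map-pred [] = refl
maxEntry-map-pred (x ∷ xs) = trans (cong (pred x ⊔_) (maxEntry-map-pred xs)) (sym (pred-⊔ x _))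
  where
  pred-⊔ : ∀ m n → pred (m ⊔ n) ≡ pred m ⊔ pred n
  pred-⊔ zero n = refl
  pred-⊔ (suc m) zero = sym (⊔-identityʳ m)
  pred-⊔ (suc m) (suc n) = refl

maxEntry-upper : ∀ xs → All (_≤ maxEntry xs) xs
maxEntry-upper [] = []
maxEntry-upper (x ∷ xs) = m≤m⊔n x _ ∷ All-map (λ y≤ → ≤-trans y≤ (m≤n⊔m x _)) (maxEntry-upper xs)

maxEntry-∈ : ∀ x xs → Any (_≡ maxEntry (x ∷ xs)) (x ∷ xs)
maxEntry-∈ x [] = here (sym (⊔-identityʳ x))
maxEntry-∈ x (y ∷ xs) with ⊔-sel x (maxEntry (y ∷ xs))
... | inj₁ e = here (sym e)
... | inj₂ e = there (Any-map (λ q → trans q (sym e)) (maxEntry-∈ y xs))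

decorationAtLast : ℕ → List (ℕ × Bool) → Maybe Bool
decorationAtLast M [] = nothing
decorationAtLast M ((x , b) ∷ ps) = decorationAtLast M ps <∣> (if x ≡ᵇ M then just b else nothing)

lastIndexOf : ℕ → List ℕ → Maybe ℕ
lastIndexOf M [] = nothing
lastIndexOf M (x ∷ xs) = Maybe.map suc (lastIndexOf M xs) <∣> (if x ≡ᵇ M then just 0 else nothing)

decorationAtLast≡getB : ∀ M a d → length d ≡ length a → decorationAtLast M (zip a d) ≡ Maybe.map (getB d) (lastIndexOf M a)
decorationAtLast≡getB M [] [] _ = refl
decorationAtLast≡getB M (x ∷ a) (b ∷ d) e = begin
    decorationAtLast M (zip a d) <∣> (if x ≡ᵇ M then just b else nothing)
  ≡⟨ cong₂ _<∣>_ (trans (decorationAtLast≡getB M a d (suc-injective e)) (map-map (lastIndexOf M a))) (here-case (x ≡ᵇ M)) ⟩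
    Maybe.map (getB (b ∷ d)) (Maybe.map suc (lastIndexOf M a)) <∣> Maybe.map (getB (b ∷ d)) (if x ≡ᵇ M then just 0 else nothing)
  ≡⟨ sym (map-<∣> (getB (b ∷ d)) (Maybe.map suc (lastIndexOf M a)) _) ⟩
    Maybe.map (getB (b ∷ d)) (lastIndexOf M (x ∷ a)) ∎
  where
  open ≡-Reasoning
  map-map : ∀ m → Maybe.map (getB d) m ≡ Maybe.map (getB (b ∷ d)) (Maybe.map suc m)
  map-map (just i) = refl
  map-map nothing = refl
  here-case : ∀ c → (if c then just b else nothing) ≡ Maybe.map (getB (b ∷ d)) (if c then just 0 else nothing)
  here-case true = refl
  here-case false = refl

lastIndexOf-from : ∀ M k a →
  foldr (λ p acc → if proj₂ p ≡ᵇ M then proj₁ p ⊔ acc else acc) 0 (enumerateFrom k a) ≡ maybe′ (k +_) 0 (lastIndexOf M a)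
lastIndexOf-from M k [] = refl
lastIndexOf-from M k (x ∷ a) rewrite lastIndexOf-from M (suc k) a with lastIndexOf M a | x ≡ᵇ M
... | just i | true = trans (m≤n⇒m⊔n≡n (≤-trans (n≤1+n k) (m≤m+n (suc k) i))) (sym (+-suc k i))
... | just i | false = sym (+-suc k i)
... | nothing | true = trans (⊔-identityʳ k) (sym (+-identityʳ k))
... | nothing | false = refl

topRowUndecorated-via-last : ∀ a d b → length d ≡ length a → decorationAtLast (maxEntry a) (zip a d) ≡ just b →
  topRowUndecorated a d ≡ not b
topRowUndecorated-via-last a d b len e
  rewrite indexed≡enumerateFrom0 a | lastIndexOf-from (maxEntry a) 0 a | decorationAtLast≡getB (maxEntry a) a d len
  with lastIndexOf (maxEntry a) a
... | just i = cong not (just-injective e)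

decorationAtLast-++ : ∀ M xs ys → decorationAtLast M (xs ++ ys) ≡ decorationAtLast M ys <∣> decorationAtLast M xs
decorationAtLast-++ M [] ys = sym (<∣>-identityʳ _)
decorationAtLast-++ M ((x , b) ∷ xs) ys =
  trans (cong (_<∣> _) (decorationAtLast-++ M xs ys)) (<∣>-assoc (decorationAtLast M ys) _ _)

decorationAtLast-∷ : ∀ M p ps {b} → decorationAtLast M ps ≡ just b → decorationAtLast M (p ∷ ps) ≡ just b
decorationAtLast-∷ M (x , c) ps e = cong (_<∣> (if x ≡ᵇ M then just c else nothing)) e

decorationAtLast-++ʳ : ∀ M xs ys {b} → decorationAtLast M ys ≡ just b → decorationAtLast M (xs ++ ys) ≡ just b
decorationAtLast-++ʳ M xs ys e = trans (decorationAtLast-++ M xs ys) (cong (_<∣> decorationAtLast M xs) e)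

decorationAtLast-++ˡ : ∀ M xs ys {b} → decorationAtLast M ys ≡ nothing → decorationAtLast M xs ≡ just b →
  decorationAtLast M (xs ++ ys) ≡ just b
decorationAtLast-++ˡ M xs ys none e = trans (decorationAtLast-++ M xs ys) (trans (cong (_<∣> decorationAtLast M xs) none) e)

decorationAtLast-below : ∀ M xs (ds : List Bool) → All (_< M) xs → decorationAtLast M (zip xs ds) ≡ nothing
decorationAtLast-below M [] ds _ = refl
decorationAtLast-below M (x ∷ xs) [] _ = refl
decorationAtLast-below M (x ∷ xs) (b ∷ ds) (x<M ∷ below) rewrite decorationAtLast-below M xs ds below
  with x ≡ᵇ M in eq
... | true = ⊥-elim (<-irrefl (≡ᵇ⇒≡ x M (Equivalence.from T-≡ eq)) x<M)
... | false = refl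

decorationAtLast-∈ : ∀ M xs (ds : List Bool) → length ds ≡ length xs → Any (_≡ M) xs →
  Σ[ b ∈ Bool ] decorationAtLast M (zip xs ds) ≡ just b
decorationAtLast-∈ M (x ∷ xs) (b ∷ ds) e (here refl) with decorationAtLast M (zip xs ds)
... | just b' = b' , refl
... | nothing rewrite Equivalence.to T-≡ (≡⇒≡ᵇ x x refl) = b , refl
decorationAtLast-∈ M (x ∷ xs) (b ∷ ds) e (there M∈) with decorationAtLast M (zip xs ds) | decorationAtLast-∈ M xs ds (suc-injective e) M∈
... | just b' | _ = b' , refl

decorationAtLast-pred : ∀ M xs (ds : List Bool) → Positive xs → 0 < M →
  decorationAtLast (pred M) (zip (map pred xs) ds) ≡ decorationAtLast M (zip xs ds)
decorationAtLast-pred M [] ds _ _ = refl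
decorationAtLast-pred M (x ∷ xs) [] _ _ = refl
decorationAtLast-pred (suc M) (suc x ∷ xs) (b ∷ ds) (_ ∷ pos) M>0 =
  cong (_<∣> (if x ≡ᵇ M then just b else nothing)) (decorationAtLast-pred (suc M) xs ds pos M>0)

-- The last row of maximal height is the same row before and after the rotation:
-- it lies in r when max s ≤ max r (lowering s keeps it below max r), and in s otherwise.
decorationAtLast-rotate : ∀ s₁ r (ds dr : List Bool) d₀ → Positive s₁ → StartsOnDiagonal r →
  length ds ≡ suc (length s₁) → length dr ≡ length r → let s = 1 ∷ s₁ in
  Σ[ b ∈ Bool ] decorationAtLast (maxEntry (0 ∷ s ++ r)) ((0 , d₀) ∷ zip s ds ++ zip r dr) ≡ just b
              × decorationAtLast (maxEntry (r ++ map pred s)) (zip r dr ++ zip (map pred s) ds) ≡ just b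
decorationAtLast-rotate s₁ r ds dr d₀ pos-s₁ r₀ len-ds len-dr with maxEntry (1 ∷ s₁) ≤? maxEntry r
... | yes s≤r = max-in-r r len-dr s≤r
  where
  s = 1 ∷ s₁
  max-in-r : ∀ r → length dr ≡ length r → maxEntry s ≤ maxEntry r →
    Σ[ b ∈ Bool ] decorationAtLast (maxEntry (0 ∷ s ++ r)) ((0 , d₀) ∷ zip s ds ++ zip r dr) ≡ just b
                × decorationAtLast (maxEntry (r ++ map pred s)) (zip r dr ++ zip (map pred s) ds) ≡ just b
  max-in-r [] _ s≤r with ≤-trans (m≤m⊔n 1 (maxEntry s₁)) s≤r
  ... | ()
  max-in-r t@(x ∷ r') len-dr s≤r with decorationAtLast-∈ (maxEntry t) t dr len-dr (maxEntry-∈ x r')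
  ... | b , at-r = b , at-D , at-D'
    where
    M = maxEntry t
    s'<M : All (_< M) (map pred s)
    s'<M = lowered-below s (z<s ∷ pos-s₁) (All-map (λ y≤ → ≤-trans y≤ s≤r) (maxEntry-upper s))
      where
      lowered-below : ∀ xs → Positive xs → All (_≤ M) xs → All (_< M) (map pred xs)
      lowered-below [] _ _ = []
      lowered-below (suc y ∷ xs) (_ ∷ pos) (y<M ∷ below) = y<M ∷ lowered-below xs pos below
    at-D : decorationAtLast (maxEntry (0 ∷ s ++ t)) ((0 , d₀) ∷ zip s ds ++ zip t dr) ≡ just b
    at-D = subst (λ m → decorationAtLast m ((0 , d₀) ∷ zip s ds ++ zip t dr) ≡ just b) (sym (trans (maxEntry-++ s t) (m≤n⇒m⊔n≡n s≤r)))
      (decorationAtLast-∷ M (0 , d₀) (zip s ds ++ zip t dr) (decorationAtLast-++ʳ M (zip s ds) (zip t dr) at-r))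
    at-D' : decorationAtLast (maxEntry (t ++ map pred s)) (zip t dr ++ zip (map pred s) ds) ≡ just b
    at-D' = subst (λ m → decorationAtLast m (zip t dr ++ zip (map pred s) ds) ≡ just b)
      (sym (trans (maxEntry-++ t (map pred s)) (m≥n⇒m⊔n≡m (≤-trans (≤-reflexive (maxEntry-map-pred s)) (≤-trans (pred-mono-≤ s≤r) pred[n]≤n)))))
      (decorationAtLast-++ˡ M (zip t dr) (zip (map pred s) ds) (decorationAtLast-below M (map pred s) ds s'<M) at-r)
... | no s≰r = b , at-D , at-D'
  where
  s = 1 ∷ s₁
  M = maxEntry s
  r<M : maxEntry r < M
  r<M = ≰⇒> s≰r
  in-s = decorationAtLast-∈ M s ds len-ds (maxEntry-∈ 1 s₁)
  b = proj₁ in-s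
  at-D : decorationAtLast (maxEntry (0 ∷ s ++ r)) ((0 , d₀) ∷ zip s ds ++ zip r dr) ≡ just b
  at-D = subst (λ m → decorationAtLast m ((0 , d₀) ∷ zip s ds ++ zip r dr) ≡ just b) (sym (trans (maxEntry-++ s r) (m≥n⇒m⊔n≡m (<⇒≤ r<M))))
    (decorationAtLast-∷ M (0 , d₀) (zip s ds ++ zip r dr) (decorationAtLast-++ˡ M (zip s ds) (zip r dr)
      (decorationAtLast-below M r dr (All-map (λ y≤ → ≤-<-trans y≤ r<M) (maxEntry-upper r))) (proj₂ in-s)))
  at-D' : decorationAtLast (maxEntry (r ++ map pred s)) (zip r dr ++ zip (map pred s) ds) ≡ just b
  at-D' = subst (λ m → decorationAtLast m (zip r dr ++ zip (map pred s) ds) ≡ just b)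
    (sym (trans (maxEntry-++ r (map pred s)) (trans (cong (maxEntry r ⊔_) (maxEntry-map-pred s)) (m≤n⇒m⊔n≡n (<⇒≤pred r<M)))))
    (decorationAtLast-++ʳ (pred M) (zip r dr) (zip (map pred s) ds)
      (trans (decorationAtLast-pred M s ds (z<s ∷ pos-s₁) (m≤m⊔n 1 (maxEntry s₁))) (proj₂ in-s)))

-- Rotating the first return

mapWithContext-++ : {B : Set} (f : List ℕ → ℕ → List ℕ → B) (pre xs ys : List ℕ) →
  mapWithContext f pre (xs ++ ys) ≡ mapWithContext (λ p x q → f p x (q ++ ys)) pre xs ++ mapWithContext f (pre ++ xs) ys
mapWithContext-++ f pre [] ys = cong (λ p → mapWithContext f p ys) (sym (++-identityʳ pre))
mapWithContext-++ f pre (x ∷ xs) ys = cong (f pre x (xs ++ ys) ∷_) (trans (mapWithContext-++ f (pre ++ x ∷ []) xs ys)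
  (cong (λ p → mapWithContext (λ p x q → f p x (q ++ ys)) (pre ++ x ∷ []) xs ++ mapWithContext f p ys) (++-assoc pre (x ∷ []) xs)))

mapWithContext-transport : {B : Set} (f g : List ℕ → ℕ → List ℕ → B) (h : ℕ → ℕ) (Q : ℕ → Set) (pf pg : List ℕ) →
  (∀ p x q → All Q p → Q x → All Q q → f (pf ++ p) x q ≡ g (pg ++ map h p) (h x) (map h q)) →
  ∀ p xs → All Q p → All Q xs → mapWithContext f (pf ++ p) xs ≡ mapWithContext g (pg ++ map h p) (map h xs)
mapWithContext-transport f g h Q pf pg H p [] _ _ = refl
mapWithContext-transport f g h Q pf pg H p (x ∷ xs) Qp (Qx ∷ Qxs) = cong₂ _∷_ (H p x xs Qp Qx Qxs)
  (trans (cong (λ p' → mapWithContext f p' xs) (++-assoc pf p (x ∷ [])))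
  (trans (mapWithContext-transport f g h Q pf pg H (p ++ x ∷ []) xs (All-++⁺ Qp (Qx ∷ [])) Qxs)
  (cong (λ p' → mapWithContext g p' (map h xs)) (trans (cong (pg ++_) (map-++ h p (x ∷ []))) (sym (++-assoc pg (map h p) (h x ∷ [])))))))

mapWithContext-reframe : {B : Set} (f g : List ℕ → ℕ → List ℕ → B) (pf pg : List ℕ) →
  (∀ p x q → f (pf ++ p) x q ≡ g (pg ++ p) x q) →
  ∀ p xs → mapWithContext f (pf ++ p) xs ≡ mapWithContext g (pg ++ p) xs
mapWithContext-reframe f g pf pg H p [] = refl
mapWithContext-reframe f g pf pg H p (x ∷ xs) = cong₂ _∷_ (H p x xs)
  (trans (cong (λ p' → mapWithContext f p' xs) (++-assoc pf p (x ∷ [])))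
  (trans (mapWithContext-reframe f g pf pg H (p ++ x ∷ []) xs)
  (cong (λ p' → mapWithContext g p' xs) (sym (++-assoc pg p (x ∷ []))))))

occ-map-pred : ∀ x ys → Positive ys → occ x (map pred ys) ≡ occ (suc x) ys
occ-map-pred x [] _ = refl
occ-map-pred x (suc y ∷ ys) (_ ∷ pos) = cong (𝟙 (y ≡ᵇ x) +_) (occ-map-pred x ys pos)

occ-zero-positive : ∀ xs → Positive xs → occ 0 xs ≡ 0
occ-zero-positive [] _ = refl
occ-zero-positive (suc x ∷ xs) (_ ∷ pos) = occ-zero-positive xs pos

nextIsRise-fromDiagonal : ∀ x r → StartsOnDiagonal r → nextIsRise x r ≡ false
nextIsRise-fromDiagonal x [] _ = refl
nextIsRise-fromDiagonal x (.0 ∷ _) refl = refl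

-- A row of s keeps its b-value when lowered: the rows of r of its height move from after it
-- to before it, where they count as rows one higher than the lowered row.
rowData-lowered : ∀ s r → Positive s → StartsOnDiagonal r →
  mapWithContext rowData r (map pred s) ≡ mapWithContext (λ p x q → rowData p x (q ++ r)) (0 ∷ []) s
rowData-lowered s r pos-s r₀ = sym (trans
  (mapWithContext-transport (λ p x q → rowData p x (q ++ r)) rowData pred (0 <_) (0 ∷ []) r same-row [] s [] pos-s)
  (cong (λ p → mapWithContext rowData p (map pred s)) (++-identityʳ r)))
  where
  same-rise : ∀ x q → 0 < x → Positive q → nextIsRise x (q ++ r) ≡ nextIsRise (pred x) (map pred q)
  same-rise (suc x) [] _ _ = nextIsRise-fromDiagonal (suc x) r r₀
  same-rise (suc x) (suc y ∷ q) _ _ = refl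
  same-rise (suc x) (zero ∷ q) _ (() ∷ _)
  same-row : ∀ p x q → Positive p → 0 < x → Positive q →
    rowData ((0 ∷ []) ++ p) x (q ++ r) ≡ rowData (r ++ map pred p) (pred x) (map pred q)
  same-row p (suc x) q pos-p x>0 pos-q = cong₂ _,_ (same-rise (suc x) q x>0 pos-q) (begin
      occ (suc x) (q ++ r) + occ (suc (suc x)) p
    ≡⟨ cong (_+ occ (suc (suc x)) p) (occ-++ (suc x) q r) ⟩
      (occ (suc x) q + occ (suc x) r) + occ (suc (suc x)) p
    ≡⟨ +-assoc (occ (suc x) q) _ _ ⟩
      occ (suc x) q + (occ (suc x) r + occ (suc (suc x)) p)
    ≡⟨ cong₂ _+_ (sym (occ-map-pred x q pos-q)) (cong (occ (suc x) r +_) (sym (occ-map-pred (suc x) p pos-p))) ⟩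
      occ x (map pred q) + (occ (suc x) r + occ (suc x) (map pred p))
    ≡⟨ cong (occ x (map pred q) +_) (sym (occ-++ (suc x) r (map pred p))) ⟩
      occ x (map pred q) + occ (suc x) (r ++ map pred p) ∎)
    where open ≡-Reasoning

-- Symmetrically, the rows of s one higher than a row of r move from before it to after it.
rowData-rest : ∀ s₁ r → Positive s₁ →
  mapWithContext (λ p x q → rowData p x (q ++ map pred (1 ∷ s₁))) [] r ≡ mapWithContext rowData (0 ∷ 1 ∷ s₁) r
rowData-rest s₁ r pos-s₁ = sym (trans (cong (λ p → mapWithContext rowData p r) (sym (++-identityʳ (0 ∷ s))))
  (mapWithContext-reframe rowData (λ p x q → rowData p x (q ++ map pred s)) (0 ∷ s) [] same-row [] r))
  where
  s = 1 ∷ s₁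
  same-rise : ∀ x q → nextIsRise x q ≡ nextIsRise x (q ++ map pred s)
  same-rise x [] = refl
  same-rise x (y ∷ q) = refl
  same-row : ∀ p x q → rowData ((0 ∷ s) ++ p) x q ≡ rowData p x (q ++ map pred s)
  same-row p x q = cong₂ _,_ (same-rise x q) (begin
      occ x q + occ (suc x) (s ++ p)
    ≡⟨ cong (occ x q +_) (occ-++ (suc x) s p) ⟩
      occ x q + (occ (suc x) s + occ (suc x) p)
    ≡⟨ sym (+-assoc (occ x q) _ _) ⟩
      (occ x q + occ (suc x) s) + occ (suc x) p
    ≡⟨ cong (λ n → (occ x q + n) + occ (suc x) p) (sym (occ-map-pred x s (z<s ∷ pos-s₁))) ⟩
      (occ x q + occ x (map pred s)) + occ (suc x) p
    ≡⟨ cong (_+ occ (suc x) p) (sym (occ-++ x q (map pred s))) ⟩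
      occ x (q ++ map pred s) + occ (suc x) p ∎)
    where open ≡-Reasoning

zip-++ : {A B : Set} (xs ys : List A) (us vs : List B) → length xs ≡ length us → zip (xs ++ ys) (us ++ vs) ≡ zip xs us ++ zip ys vs
zip-++ [] ys [] vs _ = refl
zip-++ (x ∷ xs) ys (u ∷ us) vs e = cong ((x , u) ∷_) (zip-++ xs ys us vs (suc-injective e))

lowerRow : Row → Row
lowerRow r = ((pred (height r) , decorated r) , proj₂ r)

zip-map-pred : (s : List ℕ) (ds : List Bool) (gs : List (Bool × ℕ)) →
  zip (zip (map pred s) ds) gs ≡ map lowerRow (zip (zip s ds) gs)
zip-map-pred [] ds gs = refl
zip-map-pred (x ∷ s) [] gs = refl
zip-map-pred (x ∷ s) (b ∷ ds) [] = refl
zip-map-pred (x ∷ s) (b ∷ ds) (g ∷ gs) = cong (((pred x , b) , g) ∷_) (zip-map-pred s ds gs)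

∑riseLoss-lower : ∀ xs ds gs → Positive xs → let rs = zip (zip xs ds) gs in
  ∑ riseLoss rs ≡ ∑ riseLoss (map lowerRow rs) + ∑ decoratedRise rs
∑riseLoss-lower [] ds gs _ = refl
∑riseLoss-lower (x ∷ xs) [] gs _ = refl
∑riseLoss-lower (x ∷ xs) (b ∷ ds) [] _ = refl
∑riseLoss-lower (suc x ∷ xs) (b ∷ ds) ((ρ , _) ∷ gs) (_ ∷ pos) rewrite ∑riseLoss-lower xs ds gs pos with b ∧ ρ
... | true = arith x _ _
  where
  arith : ∀ x m n → suc (suc x) + (m + n) ≡ (suc x + m) + (1 + n)
  arith = solve-∀
... | false = refl

sum-map-pred : ∀ xs → Positive xs → sum xs ≡ sum (map pred xs) + length xs
sum-map-pred [] _ = refl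
sum-map-pred (suc x ∷ xs) (_ ∷ pos) rewrite sum-map-pred xs pos = arith x _ _
  where
  arith : ∀ x m n → suc (x + (m + n)) ≡ (x + m) + suc n
  arith = solve-∀

+-∸-+-cancel : ∀ {X Y} A k → Y ≤ X → (X + (A + k)) ∸ (Y + k) ≡ (X ∸ Y) + A
+-∸-+-cancel {X} {Y} A k Y≤X = begin
    (X + (A + k)) ∸ (Y + k)   ≡⟨ cong₂ _∸_ (arith X A k) (+-comm Y k) ⟩
    (k + (X + A)) ∸ (k + Y)   ≡⟨ [m+n]∸[m+o]≡n∸o k (X + A) Y ⟩
    (X + A) ∸ Y               ≡⟨ +-∸-comm A Y≤X ⟩
    (X ∸ Y) + A               ∎
  where
  open ≡-Reasoning
  arith : ∀ X A k → X + (A + k) ≡ k + (X + A)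
  arith = solve-∀

take-++ : {A : Set} (xs ys : List A) → take (length xs) (xs ++ ys) ≡ xs
take-++ [] ys = refl
take-++ (x ∷ xs) ys = cong (x ∷_) (take-++ xs ys)

drop-++ : {A : Set} (xs ys : List A) → drop (length xs) (xs ++ ys) ≡ ys
drop-++ [] ys = refl
drop-++ (x ∷ xs) ys = drop-++ xs ys

length-take-+ : {A : Set} (m n : ℕ) (xs : List A) → length xs ≡ m + n → length (take m xs) ≡ m
length-take-+ m n xs e = trans (length-take m xs) (trans (cong (m ⊓_) e) (m≤n⇒m⊓n≡m (m≤m+n m n)))

length-drop-+ : {A : Set} (m n : ℕ) (xs : List A) → length xs ≡ m + n → length (drop m xs) ≡ n
length-drop-+ m n xs e = trans (length-drop m xs) (trans (cong (_∸ m) e) (m+n∸m≡n m n))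

++-split : {A : Set} (xs us ys vs : List A) → length xs ≡ length us → xs ++ ys ≡ us ++ vs → xs ≡ us × ys ≡ vs
++-split [] [] ys vs _ e = refl , e
++-split (x ∷ xs) (u ∷ us) ys vs len e with ∷-injectiveˡ e | ++-split xs us ys vs (suc-injective len) (∷-injectiveʳ e)
... | refl | refl , e' = refl , e'

map-suc-pred : ∀ xs → Positive xs → map suc (map pred xs) ≡ xs
map-suc-pred [] _ = refl
map-suc-pred (suc x ∷ xs) (_ ∷ pos) = cong (suc x ∷_) (map-suc-pred xs pos)

map-pred-suc : ∀ xs → map pred (map suc xs) ≡ xs
map-pred-suc xs = trans (sym (map-∘ xs)) (map-id xs)

positive-map-suc : ∀ xs → Positive (map suc xs)
positive-map-suc xs = All-map⁺ (tabulate (λ _ → z<s))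

StartsOnDiagonal-++ : ∀ r ys → StartsOnDiagonal r → StartsOnDiagonal ys → StartsOnDiagonal (r ++ ys)
StartsOnDiagonal-++ [] ys _ ys₀ = ys₀
StartsOnDiagonal-++ (.0 ∷ r) ys refl _ = refl

lastOr : ℕ → List ℕ → ℕ
lastOr p [] = p
lastOr p (x ∷ xs) = lastOr x xs

IsAreaTail-++⁻ : ∀ p xs ys → IsAreaTail p (xs ++ ys) → IsAreaTail p xs × IsAreaTail (lastOr p xs) ys
IsAreaTail-++⁻ p [] ys t = tt , t
IsAreaTail-++⁻ p (x ∷ xs) ys (x≤ , t) = let (t₁ , t₂) = IsAreaTail-++⁻ x xs ys t in (x≤ , t₁) , t₂

IsAreaTail-++⁺ : ∀ p xs ys → IsAreaTail p xs → IsAreaTail (lastOr p xs) ys → IsAreaTail p (xs ++ ys)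
IsAreaTail-++⁺ p [] ys _ t = t
IsAreaTail-++⁺ p (x ∷ xs) ys (x≤ , t₁) t₂ = x≤ , IsAreaTail-++⁺ x xs ys t₁ t₂

IsAreaTail-fromDiagonal : ∀ p q xs → StartsOnDiagonal xs → IsAreaTail p xs → IsAreaTail q xs
IsAreaTail-fromDiagonal p q [] _ _ = tt
IsAreaTail-fromDiagonal p q (.0 ∷ xs) refl (_ , t) = z≤n , t

IsAreaTail-map-pred : ∀ p xs → Positive xs → IsAreaTail (suc p) xs → IsAreaTail p (map pred xs)
IsAreaTail-map-pred p [] _ _ = tt
IsAreaTail-map-pred p (suc x ∷ xs) (_ ∷ pos) (s≤s x≤ , t) = x≤ , IsAreaTail-map-pred x xs pos t

IsAreaTail-map-suc : ∀ p xs → IsAreaTail p xs → IsAreaTail (suc p) (map suc xs)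
IsAreaTail-map-suc p [] _ = tt
IsAreaTail-map-suc p (x ∷ xs) (x≤ , t) = s≤s x≤ , IsAreaTail-map-suc x xs t

-- Split an area sequence before its (k+1)-st entry 0.
splitBeforeZero : ℕ → List ℕ → List ℕ × List ℕ
splitBeforeZero k [] = ([] , [])
splitBeforeZero k (suc x ∷ xs) = (suc x ∷ proj₁ (splitBeforeZero k xs) , proj₂ (splitBeforeZero k xs))
splitBeforeZero zero (zero ∷ xs) = ([] , zero ∷ xs)
splitBeforeZero (suc k) (zero ∷ xs) = (zero ∷ proj₁ (splitBeforeZero k xs) , proj₂ (splitBeforeZero k xs))

splitBeforeZero-++ : ∀ r t → splitBeforeZero (occ 0 r) (r ++ 0 ∷ t) ≡ (r , 0 ∷ t)
splitBeforeZero-++ [] t = refl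
splitBeforeZero-++ (zero ∷ r) t rewrite splitBeforeZero-++ r t = refl
splitBeforeZero-++ (suc x ∷ r) t rewrite splitBeforeZero-++ r t = refl

splitBeforeZero-glue : ∀ k xs → xs ≡ proj₁ (splitBeforeZero k xs) ++ proj₂ (splitBeforeZero k xs)
splitBeforeZero-glue k [] = refl
splitBeforeZero-glue zero (zero ∷ xs) = refl
splitBeforeZero-glue (suc k) (zero ∷ xs) = cong (zero ∷_) (splitBeforeZero-glue k xs)
splitBeforeZero-glue k (suc x ∷ xs) = cong (suc x ∷_) (splitBeforeZero-glue k xs)

splitBeforeZero-cases : ∀ k xs → let (u , v) = splitBeforeZero k xs in
  (v ≡ [] × occ 0 u ≤ k) ⊎ (Σ[ t ∈ List ℕ ] v ≡ 0 ∷ t × occ 0 u ≡ k)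
splitBeforeZero-cases k [] = inj₁ (refl , z≤n)
splitBeforeZero-cases zero (zero ∷ xs) = inj₂ (xs , refl , refl)
splitBeforeZero-cases (suc k) (zero ∷ xs) with splitBeforeZero-cases k xs
... | inj₁ (e , u≤k) = inj₁ (e , s≤s u≤k)
... | inj₂ (t , e , u≡k) = inj₂ (t , e , cong suc u≡k)
splitBeforeZero-cases k (suc x ∷ xs) = splitBeforeZero-cases k xs

splitBeforeZero-fromDiagonal : ∀ k xs → StartsOnDiagonal xs → StartsOnDiagonal (proj₁ (splitBeforeZero k xs))
splitBeforeZero-fromDiagonal k [] _ = tt
splitBeforeZero-fromDiagonal zero (zero ∷ xs) _ = tt
splitBeforeZero-fromDiagonal (suc k) (zero ∷ xs) _ = refl

span-positive : ∀ xs ys → Positive xs → StartsOnDiagonal ys → span (0 <?_) (xs ++ ys) ≡ (xs , ys)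
span-positive [] [] _ _ = refl
span-positive [] (.0 ∷ ys) _ refl = refl
span-positive (suc x ∷ xs) ys (_ ∷ pos) ys₀ rewrite span-positive xs ys pos ys₀ = refl

span-positive⁻ : ∀ t → t ≡ proj₁ (span (0 <?_) t) ++ proj₂ (span (0 <?_) t)
  × Positive (proj₁ (span (0 <?_) t)) × StartsOnDiagonal (proj₂ (span (0 <?_) t))
span-positive⁻ [] = refl , [] , tt
span-positive⁻ (zero ∷ t) = refl , [] , refl
span-positive⁻ (suc x ∷ t) = let (e , pos , t₀) = span-positive⁻ t in cong (suc x ∷_) e , z<s ∷ pos , t₀

record FirstReturn : Set where
  constructor firstReturn
  field
    s₁ r : List ℕ
    ds dr : List Bool
    pos-s₁ : Positive s₁
    r₀ : StartsOnDiagonal r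
    len-ds : length ds ≡ suc (length s₁)
    len-dr : length dr ≡ length r

-- glue d₀ R has area sequence 0, 1 ∷ s₁, r (so 1 ∷ s₁ is its first return) and row 0 decorated
-- by d₀; rotate R removes row 0 and moves the first return, lowered by one, behind r.
glue : Bool → FirstReturn → DecPath
glue d₀ R = (0 ∷ (1 ∷ s₁) ++ r , d₀ ∷ ds ++ dr) where open FirstReturn R

rotate : FirstReturn → DecPath
rotate R = (r ++ map pred (1 ∷ s₁) , dr ++ ds) where open FirstReturn R

-- Total maps extending glue d₀ R ↦ rotate R and its inverse; k counts the returns in r.
rotatePath : DecPath → DecPath
rotatePath (a , d) =
  let (s , r) = span (0 <?_) (drop 1 a) ; n = length s in
  (r ++ map pred s , drop n (drop 1 d) ++ take n (drop 1 d))

unrotatePath : ℕ → Bool → DecPath → DecPath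
unrotatePath k d₀ (a , d) =
  let (u , v) = splitBeforeZero k a ; n = length u in
  (0 ∷ map suc v ++ u , d₀ ∷ drop n d ++ take n d)

-- The first part counts row 0 unless row 0 is a decorated (double) rise.
firstPart-split : ∀ b c A → c + (if b ∧ true then 0 else 1) ≡ suc A → c ≡ (if b then suc A else A)
firstPart-split false c A e = suc-injective (trans (+-comm 1 c) e)
firstPart-split true c A e = trans (sym (+-identityʳ c)) e

firstPart-join : ∀ b c A → c ≡ (if b then suc A else A) → c + (if b ∧ true then 0 else 1) ≡ suc A
firstPart-join false c A e = trans (cong (_+ 1) e) (+-comm A 1)
firstPart-join true c A e = trans (cong (_+ 0) e) (+-identityʳ (suc A))

module Rotation (R : FirstReturn) (d₀ : Bool) where
  open FirstReturn R

  s : List ℕ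
  s = 1 ∷ s₁

  pos-s : Positive s
  pos-s = z<s ∷ pos-s₁

  heights heights′ : List ℕ
  heights = 0 ∷ s ++ r
  heights′ = r ++ map pred s

  decos decos′ : List Bool
  decos = d₀ ∷ ds ++ dr
  decos′ = dr ++ ds

  row₀ : Row
  row₀ = ((0 , d₀) , rowData [] 0 (s ++ r))

  GS GR : List (Bool × ℕ)
  GS = mapWithContext (λ p x q → rowData p x (q ++ r)) (0 ∷ []) s
  GR = mapWithContext rowData (0 ∷ s) r

  RS RR : List Row
  RS = zip (zip s ds) GS
  RR = zip (zip r dr) GR

  length-glue : length decos ≡ length heights
  length-glue = cong suc (trans (length-++ ds) (trans (cong₂ _+_ len-ds len-dr) (sym (length-++ s))))

  length-rotate : length decos′ ≡ length heights′
  length-rotate = trans (length-++ dr) (trans (cong₂ _+_ len-dr (trans len-ds (sym (length-map pred s)))) (sym (length-++ r)))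

  rows-glue : rows (glue d₀ R) ≡ row₀ ∷ RS ++ RR
  rows-glue = cong (row₀ ∷_) (begin
      zip (zip (s ++ r) (ds ++ dr)) (mapWithContext rowData (0 ∷ []) (s ++ r))
    ≡⟨ cong₂ zip (zip-++ s r ds dr (sym len-ds)) (mapWithContext-++ rowData (0 ∷ []) s r) ⟩
      zip (zip s ds ++ zip r dr) (GS ++ GR)
    ≡⟨ zip-++ (zip s ds) (zip r dr) GS GR (trans (length-zip s ds len-ds) (sym (length-mapWithContext _ (0 ∷ []) s))) ⟩
      RS ++ RR ∎)
    where open ≡-Reasoning

  rows-rotate : rows (rotate R) ≡ RR ++ map lowerRow RS
  rows-rotate = begin
      zip (zip (r ++ map pred s) (dr ++ ds)) (mapWithContext rowData [] (r ++ map pred s))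
    ≡⟨ cong₂ zip (zip-++ r (map pred s) dr ds (sym len-dr))
         (trans (mapWithContext-++ rowData [] r (map pred s)) (cong₂ _++_ (rowData-rest s₁ r pos-s₁) (rowData-lowered s r pos-s r₀))) ⟩
      zip (zip r dr ++ zip (map pred s) ds) (GR ++ GS)
    ≡⟨ zip-++ (zip r dr) (zip (map pred s) ds) GR GS (trans (length-zip r dr len-dr) (sym (length-mapWithContext _ (0 ∷ s) r))) ⟩
      RR ++ zip (zip (map pred s) ds) GS
    ≡⟨ cong (RR ++_) (zip-map-pred s ds GS) ⟩
      RR ++ map lowerRow RS ∎
    where open ≡-Reasoning

  ∑-rows-glue : ∀ w → ∑ w (rows (glue d₀ R)) ≡ w row₀ + (∑ w RS + ∑ w RR)
  ∑-rows-glue w = trans (cong (∑ w) rows-glue) (cong (w row₀ +_) (∑-++ w RS RR))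

  ∑-rows-rotate : ∀ w → ∑ w (rows (rotate R)) ≡ ∑ w RR + ∑ w (map lowerRow RS)
  ∑-rows-rotate w = trans (cong (∑ w) rows-rotate) (∑-++ w RR (map lowerRow RS))

  ∑-rotation-invariant : ∀ w → w row₀ ≡ 0 → (∀ x → w (lowerRow x) ≡ w x) → ∑ w (rows (glue d₀ R)) ≡ ∑ w (rows (rotate R))
  ∑-rotation-invariant w w₀ lowered = begin
      ∑ w (rows (glue d₀ R))           ≡⟨ ∑-rows-glue w ⟩
      w row₀ + (∑ w RS + ∑ w RR)       ≡⟨ cong (_+ (∑ w RS + ∑ w RR)) w₀ ⟩
      ∑ w RS + ∑ w RR                  ≡⟨ +-comm (∑ w RS) _ ⟩
      ∑ w RR + ∑ w RS                  ≡⟨ cong (∑ w RR +_) (sym (trans (∑-map w lowerRow RS) (∑-cong-∈ RS (λ {x} _ → lowered x)))) ⟩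
      ∑ w RR + ∑ w (map lowerRow RS)   ≡⟨ sym (∑-rows-rotate w) ⟩
      ∑ w (rows (rotate R))            ∎
    where open ≡-Reasoning

  peakDec-rotate : peakDec (glue d₀ R) ≡ peakDec (rotate R)
  peakDec-rotate = trans (peakDec≡∑rows heights decos length-glue)
    (trans (∑-rotation-invariant decoratedPeak (no-peak d₀) (λ _ → refl)) (sym (peakDec≡∑rows heights′ decos′ length-rotate)))
    where
    no-peak : ∀ b → 𝟙 (b ∧ not true) ≡ 0
    no-peak true = refl
    no-peak false = refl

  -- Row 0 sees exactly the returns of r; every other row keeps its b-value.
  ∑b-rotate : ∑ proj₂ (allRowData heights) ≡ ∑ proj₂ (allRowData heights′) + occ 0 r
  ∑b-rotate = begin
      proj₂ (rowData [] 0 (s ++ r)) + ∑ proj₂ (mapWithContext rowData (0 ∷ []) (s ++ r))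
    ≡⟨ cong₂ _+_ row₀-b (trans (cong (∑ proj₂) (mapWithContext-++ rowData (0 ∷ []) s r)) (∑-++ proj₂ GS GR)) ⟩
      occ 0 r + (∑ proj₂ GS + ∑ proj₂ GR)
    ≡⟨ arith (occ 0 r) (∑ proj₂ GS) (∑ proj₂ GR) ⟩
      (∑ proj₂ GR + ∑ proj₂ GS) + occ 0 r
    ≡⟨ cong (_+ occ 0 r) (sym (trans (cong (∑ proj₂) (trans (mapWithContext-++ rowData [] r (map pred s))
         (cong₂ _++_ (rowData-rest s₁ r pos-s₁) (rowData-lowered s r pos-s r₀)))) (∑-++ proj₂ GR GS))) ⟩
      ∑ proj₂ (allRowData heights′) + occ 0 r ∎
    where
    open ≡-Reasoning
    arith : ∀ a b c → a + (b + c) ≡ (c + b) + a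
    arith = solve-∀
    row₀-b : proj₂ (rowData [] 0 (s ++ r)) ≡ occ 0 r
    row₀-b = trans (+-identityʳ _) (trans (occ-++ 0 s r) (cong (_+ occ 0 r) (occ-zero-positive s pos-s)))

  dinvDec-rotate : dinvDec (glue d₀ R) ≡ dinvDec (rotate R) + occ 0 r
  dinvDec-rotate = begin
      dinv heights ∸ peakDecSum (glue d₀ R)
    ≡⟨ cong₂ _∸_ (trans (dinv≡∑rowData heights) ∑b-rotate)
         (trans (peakDecSum≡∑rows heights decos length-glue) (∑-rotation-invariant peakLoss (no-peak d₀ _) (λ _ → refl))) ⟩
      (∑ proj₂ (allRowData heights′) + occ 0 r) ∸ ∑ peakLoss (rows (rotate R))
    ≡⟨ +-∸-comm (occ 0 r) (∑peakLoss≤∑b heights′ decos′ (allRowData heights′)) ⟩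
      (∑ proj₂ (allRowData heights′) ∸ ∑ peakLoss (rows (rotate R))) + occ 0 r
    ≡⟨ cong (_+ occ 0 r) (sym (cong₂ _∸_ (dinv≡∑rowData heights′) (peakDecSum≡∑rows heights′ decos′ length-rotate))) ⟩
      dinvDec (rotate R) + occ 0 r ∎
    where
    open ≡-Reasoning
    no-peak : ∀ b (n : ℕ) → (if b ∧ not true then n else 0) ≡ 0
    no-peak true n = refl
    no-peak false n = refl

  firstPart : ℕ
  firstPart = ∑ partWeight RS + partWeight row₀

  ∑partWeight-firstPart : ∀ A → firstPart ≡ suc A → ∑ partWeight RS ≡ (if d₀ then suc A else A)
  ∑partWeight-firstPart A = firstPart-split d₀ (∑ partWeight RS) A

  firstPart-∑partWeight : ∀ A → ∑ partWeight RS ≡ (if d₀ then suc A else A) → firstPart ≡ suc A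
  firstPart-∑partWeight A = firstPart-join d₀ (∑ partWeight RS) A

  -- Each row of s loses one unit of height, and counts either towards a part or as a decorated rise.
  area-rotate : area heights ≡ area heights′ + (∑ partWeight RS + ∑ decoratedRise RS)
  area-rotate = begin
      sum (s ++ r)
    ≡⟨ sum-++ s r ⟩
      sum s + sum r
    ≡⟨ cong (_+ sum r) (sum-map-pred s pos-s) ⟩
      (sum (map pred s) + length s) + sum r
    ≡⟨ cong (λ n → (sum (map pred s) + n) + sum r) (sym (trans (∑partWeight+∑decoratedRise RS) length-RS)) ⟩
      (sum (map pred s) + (∑ partWeight RS + ∑ decoratedRise RS)) + sum r
    ≡⟨ arith (sum (map pred s)) _ (sum r) ⟩
      (sum r + sum (map pred s)) + (∑ partWeight RS + ∑ decoratedRise RS)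
    ≡⟨ cong (_+ (∑ partWeight RS + ∑ decoratedRise RS)) (sym (sum-++ r (map pred s))) ⟩
      sum (r ++ map pred s) + (∑ partWeight RS + ∑ decoratedRise RS) ∎
    where
    open ≡-Reasoning
    arith : ∀ a b c → (a + b) + c ≡ (c + a) + b
    arith = solve-∀
    length-RS : length RS ≡ length s
    length-RS = trans (length-zip (zip s ds) GS (trans (length-mapWithContext _ (0 ∷ []) s) (sym (length-zip s ds len-ds))))
      (length-zip s ds len-ds)

  ∑riseLoss-rotate : ∑ riseLoss (rows (glue d₀ R)) ≡ ∑ riseLoss (rows (rotate R)) + (𝟙 d₀ + ∑ decoratedRise RS)
  ∑riseLoss-rotate = begin
      ∑ riseLoss (rows (glue d₀ R))
    ≡⟨ ∑-rows-glue riseLoss ⟩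
      riseLoss row₀ + (∑ riseLoss RS + ∑ riseLoss RR)
    ≡⟨ cong₂ _+_ (row₀-loss d₀) (cong (_+ ∑ riseLoss RR) (∑riseLoss-lower s ds GS pos-s)) ⟩
      𝟙 d₀ + ((∑ riseLoss (map lowerRow RS) + ∑ decoratedRise RS) + ∑ riseLoss RR)
    ≡⟨ arith (𝟙 d₀) (∑ riseLoss (map lowerRow RS)) (∑ decoratedRise RS) (∑ riseLoss RR) ⟩
      (∑ riseLoss RR + ∑ riseLoss (map lowerRow RS)) + (𝟙 d₀ + ∑ decoratedRise RS)
    ≡⟨ cong (_+ (𝟙 d₀ + ∑ decoratedRise RS)) (sym (∑-rows-rotate riseLoss)) ⟩
      ∑ riseLoss (rows (rotate R)) + (𝟙 d₀ + ∑ decoratedRise RS) ∎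
    where
    open ≡-Reasoning
    arith : ∀ i l n r → i + ((l + n) + r) ≡ (r + l) + (i + n)
    arith = solve-∀
    row₀-loss : ∀ b → (if b ∧ true then 1 else 0) ≡ 𝟙 b
    row₀-loss true = refl
    row₀-loss false = refl

  areaDec-rotate : ∀ A → firstPart ≡ suc A → areaDec (glue d₀ R) ≡ areaDec (rotate R) + A
  areaDec-rotate A e = begin
      area heights ∸ riseDecSum (glue d₀ R)
    ≡⟨ cong₂ _∸_ area-rotate (trans (riseDecSum≡∑rows heights decos length-glue) ∑riseLoss-rotate) ⟩
      (area heights′ + (∑ partWeight RS + nS)) ∸ (∑ riseLoss (rows (rotate R)) + (𝟙 d₀ + nS))
    ≡⟨ cong (λ x → (area heights′ + x) ∸ (∑ riseLoss (rows (rotate R)) + (𝟙 d₀ + nS))) (split-first-part d₀ (∑partWeight-firstPart A e)) ⟩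
      (area heights′ + (A + (𝟙 d₀ + nS))) ∸ (∑ riseLoss (rows (rotate R)) + (𝟙 d₀ + nS))
    ≡⟨ +-∸-+-cancel A (𝟙 d₀ + nS) (∑riseLoss≤area heights′ decos′) ⟩
      (area heights′ ∸ ∑ riseLoss (rows (rotate R))) + A
    ≡⟨ cong (λ x → (area heights′ ∸ x) + A) (sym (riseDecSum≡∑rows heights′ decos′ length-rotate)) ⟩
      areaDec (rotate R) + A ∎
    where
    open ≡-Reasoning
    nS = ∑ decoratedRise RS
    split-first-part : ∀ b {c} → c ≡ (if b then suc A else A) → c + nS ≡ A + (𝟙 b + nS)
    split-first-part false refl = refl
    split-first-part true refl = sym (+-suc A nS)

  lastParts : List ℕ
  lastParts = compositionOf (map lowerRow RS)

  riseComp-glue : riseComp (glue d₀ R) ≡ firstPart ∷ compositionOf RR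
  riseComp-glue = begin
      riseComp (glue d₀ R)
    ≡⟨ riseComp≡compositionOf heights decos length-glue ⟩
      proj₂ (foldr compositionStep (0 , []) (rows (glue d₀ R)))
    ≡⟨ cong (λ rs → proj₂ (foldr compositionStep (0 , []) rs)) rows-glue ⟩
      proj₂ (compositionStep row₀ (foldr compositionStep (0 , []) (RS ++ RR)))
    ≡⟨ cong (λ acc → proj₂ (compositionStep row₀ acc)) (begin
         foldr compositionStep (0 , []) (RS ++ RR)
       ≡⟨ foldr-++ compositionStep (0 , []) RS RR ⟩
         foldr compositionStep (foldr compositionStep (0 , []) RR) RS
       ≡⟨ cong (λ acc → foldr compositionStep acc RS) (cong (_, compositionOf RR) (compositionOf-running-fromDiagonal r dr GR r₀)) ⟩
         foldr compositionStep (0 , compositionOf RR) RS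
       ≡⟨ foldr-compositionStep-above 0 (compositionOf RR) RS (zip-above s ds GS pos-s) ⟩
         (∑ partWeight RS , compositionOf RR) ∎) ⟩
      firstPart ∷ compositionOf RR ∎
    where open ≡-Reasoning

  lastParts-running : foldr compositionStep (0 , []) (map lowerRow RS) ≡ (0 , lastParts)
  lastParts-running = cong (_, lastParts) (trans (cong (λ rs → proj₁ (foldr compositionStep (0 , []) rs)) (sym (zip-map-pred s ds GS)))
    (compositionOf-running-fromDiagonal (map pred s) ds GS refl))

  riseComp-rotate : riseComp (rotate R) ≡ compositionOf RR ++ lastParts
  riseComp-rotate = begin
      riseComp (rotate R)
    ≡⟨ riseComp≡compositionOf heights′ decos′ length-rotate ⟩
      compositionOf (rows (rotate R))
    ≡⟨ cong compositionOf rows-rotate ⟩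
      proj₂ (foldr compositionStep (0 , []) (RR ++ map lowerRow RS))
    ≡⟨ cong proj₂ (foldr-++ compositionStep (0 , []) RR (map lowerRow RS)) ⟩
      proj₂ (foldr compositionStep (foldr compositionStep (0 , []) (map lowerRow RS)) RR)
    ≡⟨ cong (λ acc → proj₂ (foldr compositionStep acc RR)) lastParts-running ⟩
      proj₂ (foldr compositionStep (0 , lastParts) RR)
    ≡⟨ cong proj₂ (foldr-compositionStep-++ 0 lastParts RR) ⟩
      compositionOf RR ++ lastParts ∎
    where open ≡-Reasoning

  sum-lastParts : sum lastParts ≡ ∑ partWeight RS
  sum-lastParts = trans (cong (_+ sum lastParts) (sym (cong proj₁ lastParts-running)))
    (trans (compositionOf-sum (map lowerRow RS)) (∑-map partWeight lowerRow RS))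

  lastParts-positive : Positive lastParts
  lastParts-positive = All-++⁻ʳ (compositionOf RR) (subst Positive (trans (sym (riseComp≡compositionOf heights′ decos′ length-rotate)) riseComp-rotate)
    (compositionOf-positive heights′ decos′ length-rotate))

  length-compositionOf-RR : length (compositionOf RR) ≡ occ 0 r
  length-compositionOf-RR = trans (length-compositionOf RR) (∑-onDiagonal r dr GR len-dr (length-mapWithContext rowData (0 ∷ s) r))

  topRowUndecorated-rotate : topRowUndecorated heights decos ≡ topRowUndecorated heights′ decos′
  topRowUndecorated-rotate with decorationAtLast-rotate s₁ r ds dr d₀ pos-s₁ r₀ len-ds len-dr
  ... | b , at , at′ = trans
    (topRowUndecorated-via-last heights decos b length-glue (trans (cong (decorationAtLast (maxEntry heights)) (cong ((0 , d₀) ∷_) (zip-++ s r ds dr (sym len-ds)))) at))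
    (sym (topRowUndecorated-via-last heights′ decos′ b length-rotate (trans (cong (decorationAtLast (maxEntry heights′)) (zip-++ r (map pred s) dr ds (sym len-dr))) at′)))

  length-heights′ : length heights′ ≡ length (s ++ r)
  length-heights′ = trans (length-++ r) (trans (cong (length r +_) (length-map pred s)) (trans (+-comm (length r) _) (sym (length-++ s))))

  ∈-glue⇒∈-rotate : ∀ {N} → glue d₀ R ∈ decoratedPaths (suc N) → rotate R ∈ decoratedPaths N
  ∈-glue⇒∈-rotate {N} D∈ with ∈-decoratedPaths⁻ (suc N) D∈
  ... | len , (_ , _ , tail) , _ , top with IsAreaTail-++⁻ 0 s r tail
  ... | (_ , tail-s₁) , tail-r = subst (λ n → rotate R ∈ decoratedPaths n) (trans length-heights′ (suc-injective len))
    (∈-decoratedPaths⁺ (StartsOnDiagonal-++ r (map pred s) r₀ refl , tail′) length-rotate (subst T topRowUndecorated-rotate top))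
    where
    tail′ : IsAreaTail 0 heights′
    tail′ = IsAreaTail-++⁺ 0 r (map pred s) (IsAreaTail-fromDiagonal _ 0 r r₀ tail-r) (z≤n , IsAreaTail-map-pred 0 s₁ pos-s₁ tail-s₁)

  ∈-rotate⇒∈-glue : ∀ {N} → rotate R ∈ decoratedPaths N → glue d₀ R ∈ decoratedPaths (suc N)
  ∈-rotate⇒∈-glue {N} D∈ with ∈-decoratedPaths⁻ N D∈
  ... | len , (_ , tail) , _ , top with IsAreaTail-++⁻ 0 r (map pred s) tail
  ... | tail-r , (_ , tail-s₁) = subst (λ n → glue d₀ R ∈ decoratedPaths (suc n)) (trans (sym length-heights′) len)
    (∈-decoratedPaths⁺ (refl , z≤n , tail-s) length-glue (subst T (sym topRowUndecorated-rotate) top))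
    where
    tail-s : IsAreaTail 0 (s ++ r)
    tail-s = IsAreaTail-++⁺ 0 s r (s≤s z≤n , subst (IsAreaTail 1) (map-suc-pred s₁ pos-s₁) (IsAreaTail-map-suc 0 (map pred s₁) tail-s₁))
      (IsAreaTail-fromDiagonal 0 _ r r₀ tail-r)

  rotatePath-glue : rotatePath (glue d₀ R) ≡ rotate R
  rotatePath-glue rewrite span-positive s₁ r pos-s₁ r₀ = cong (heights′ ,_)
    (cong₂ _++_ (trans (cong (λ n → drop n (ds ++ dr)) (sym len-ds)) (drop-++ ds dr))
                (trans (cong (λ n → take n (ds ++ dr)) (sym len-ds)) (take-++ ds dr)))

  unrotatePath-rotate : unrotatePath (occ 0 r) d₀ (rotate R) ≡ glue d₀ R
  unrotatePath-rotate rewrite splitBeforeZero-++ r (map pred s₁) = cong₂ _,_ (cong (λ z → 0 ∷ 1 ∷ z ++ r) (map-suc-pred s₁ pos-s₁))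
    (cong (d₀ ∷_) (cong₂ _++_ (trans (cong (λ n → drop n (dr ++ ds)) (sym len-dr)) (drop-++ dr ds))
                              (trans (cong (λ n → take n (dr ++ ds)) (sym len-dr)) (take-++ dr ds))))

riseComp-quickReturn : ∀ r d₀ (d : List Bool) → StartsOnDiagonal r → length d ≡ length r →
  Σ[ β ∈ List ℕ ] riseComp (0 ∷ r , d₀ ∷ d) ≡ 1 ∷ β
riseComp-quickReturn r d₀ d r₀ len rewrite riseComp≡compositionOf (0 ∷ r) (d₀ ∷ d) (cong suc len)
  | compositionOf-running-fromDiagonal r d (mapWithContext rowData (0 ∷ []) r) r₀ | nextIsRise-fromDiagonal 0 r r₀ with d₀
... | true = _ , refl
... | false = _ , refl

glue-of-firstPart≥2 : ∀ N {a d c β} → (a , d) ∈ decoratedPaths (suc N) → riseComp (a , d) ≡ c ∷ β → 2 ≤ c →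
  Σ[ d₀ ∈ Bool ] Σ[ R ∈ FirstReturn ] (a , d) ≡ glue d₀ R
glue-of-firstPart≥2 N {a} {d} D∈ comp 2≤c with ∈-decoratedPaths⁻ (suc N) D∈
glue-of-firstPart≥2 N {[]} D∈ comp 2≤c | () , _
glue-of-firstPart≥2 N {.0 ∷ t} {[]} D∈ comp 2≤c | _ , (refl , _) , () , _
glue-of-firstPart≥2 N {.0 ∷ t} {d₀ ∷ d} D∈ comp 2≤c | len-a , (refl , _ , tail) , len-d , _ with span (0 <?_) t | span-positive⁻ t
... | [] , r | refl , _ , r₀ with riseComp-quickReturn r d₀ d r₀ (trans (suc-injective len-d) (sym (suc-injective len-a)))
... | _ , quick with trans (sym comp) quick
... | refl with 2≤c
... | s≤s ()
glue-of-firstPart≥2 N {.0 ∷ t} {d₀ ∷ d} D∈ comp 2≤c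
  | len-a , (refl , _ , tail) , len-d , _ | x ∷ s₁ , r | refl , x>0 ∷ pos-s₁ , r₀ with tail
... | x≤1 , _ with ≤-antisym x≤1 x>0
... | refl = d₀ , R , cong (λ e → 0 ∷ (1 ∷ s₁) ++ r , d₀ ∷ e) (sym (take++drop≡id (suc (length s₁)) d))
  where
  len-d' : length d ≡ suc (length s₁) + length r
  len-d' = trans (suc-injective len-d) (trans (sym (suc-injective len-a)) (length-++ (1 ∷ s₁)))
  R : FirstReturn
  R = firstReturn s₁ r (take (suc (length s₁)) d) (drop (suc (length s₁)) d) pos-s₁ r₀
    (length-take-+ _ _ d len-d') (length-drop-+ _ _ d len-d')

rotation-of-riseComp : ∀ N {a d β γ} → (a , d) ∈ decoratedPaths N → riseComp (a , d) ≡ β ++ γ → γ ≢ [] →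
  Σ[ R ∈ FirstReturn ] (a , d) ≡ rotate R × occ 0 (FirstReturn.r R) ≡ length β
rotation-of-riseComp N {a} {d} {β} {γ} D∈ comp γ≢[] with ∈-decoratedPaths⁻ N D∈
... | len-a , (a₀ , _) , len-d , _ with splitBeforeZero (length β) a | splitBeforeZero-glue (length β) a
       | splitBeforeZero-cases (length β) a | splitBeforeZero-fromDiagonal (length β) a a₀
... | u , v | a≡u++v | inj₁ (refl , occ≤) | _ = ⊥-elim (γ≢[] (length≡0 γ too-many-parts))
  where
  length≡0 : ∀ (γ : List ℕ) → length γ ≤ 0 → γ ≡ []
  length≡0 [] _ = refl
  too-many-parts : length γ ≤ 0
  too-many-parts = +-cancelˡ-≤ (length β) _ _ (begin
      length β + length γ   ≡⟨ sym (length-++ β) ⟩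
      length (β ++ γ)       ≡⟨ cong length (sym comp) ⟩
      length (riseComp (a , d)) ≡⟨ length-riseComp a d (trans len-d (sym len-a)) ⟩
      occ 0 a               ≡⟨ cong (occ 0) (trans a≡u++v (++-identityʳ u)) ⟩
      occ 0 u               ≤⟨ occ≤ ⟩
      length β              ≡⟨ sym (+-identityʳ (length β)) ⟩
      length β + 0          ∎)
    where open ≤-Reasoning
... | u , .(0 ∷ t) | a≡u++v | inj₂ (t , refl , occ≡) | u₀ = R , cong₂ _,_ a≡rotate (sym (take++drop≡id (length u) d)) , occ≡
  where
  len-d' : length d ≡ length u + suc (length t)
  len-d' = trans len-d (trans (sym len-a) (trans (cong length a≡u++v) (length-++ u)))
  R : FirstReturn
  R = firstReturn (map suc t) u (drop (length u) d) (take (length u) d) (positive-map-suc t) u₀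
    (trans (length-drop-+ _ _ d len-d') (cong suc (sym (length-map suc t)))) (length-take-+ _ _ d len-d')
  a≡rotate : a ≡ u ++ map pred (1 ∷ map suc t)
  a≡rotate = trans a≡u++v (cong (λ t' → u ++ 0 ∷ t') (sym (map-pred-suc t)))

-- Counting

inCat : ℕ → List ℕ → DecPath → Bool
inCat k α D = does (peakDec D ≟ k) ∧ does (≡-dec _≟_ (riseComp D) α)

∧-does⁻ : {P Q : Set} (p? : Dec P) (q? : Dec Q) → does p? ∧ does q? ≡ true → P × Q
∧-does⁻ (yes p) (yes q) _ = p , q
∧-does⁻ (yes _) (no _) ()
∧-does⁻ (no _) _ ()

inCat⁻ : ∀ {k α D} → inCat k α D ≡ true → peakDec D ≡ k × riseComp D ≡ α
inCat⁻ {k} {α} {D} = ∧-does⁻ (peakDec D ≟ k) (≡-dec _≟_ (riseComp D) α)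

inCat⁺ : ∀ {k α D} → peakDec D ≡ k → riseComp D ≡ α → inCat k α D ≡ true
inCat⁺ {k} {α} {D} p q = cong₂ _∧_ (dec-true (peakDec D ≟ k) p) (dec-true (≡-dec _≟_ (riseComp D) α) q)

if-pos : ∀ b {n} → 0 < (if b then n else 0) → b ≡ true
if-pos true _ = refl

stat : DecPath → ℕ × ℕ
stat D = (dinvDec D , areaDec D)

row₀Decorated : DecPath → Bool
row₀Decorated (_ , d) = getB d 0

coeff-CatRise : ∀ α k ℓ i j → coeff (CatRise α k ℓ) i j ≡ ∑ (λ D → if inCat k α D then δ i j (stat D) else 0) (decoratedPaths (sum α + ℓ))
coeff-CatRise α k ℓ i j = trans (coeff≡∑δ (CatRise α k ℓ) i j)
  (trans (∑-map (δ i j) stat (filterᵇ (inCat k α) (decoratedPaths (sum α + ℓ))))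
    (∑-filterᵇ (δ i j ∘ stat) (inCat k α) (decoratedPaths (sum α + ℓ))))

coeff-qtShift-sumComps : ∀ x y n (f : List ℕ → Poly) i j →
  coeff (qtShift x y (sumComps n f)) i j ≡ ∑ (λ γ → ∑ (λ m → δ i j (proj₁ m + x , proj₂ m + y)) (f γ)) (compositions n)
coeff-qtShift-sumComps x y n f i j = trans (coeff≡∑δ (qtShift x y (sumComps n f)) i j)
  (trans (∑-map (δ i j) (λ m → (proj₁ m + x , proj₂ m + y)) (sumComps n f)) (∑-concatMap (λ m → δ i j (proj₁ m + x , proj₂ m + y)) f (compositions n)))

-- The contributions of single paths to the coefficient of q^i t^j on the two sides.
module Counting (A k : ℕ) (β : List ℕ) (i j : ℕ) where

  lhs : DecPath → ℕ
  lhs D = if inCat k (suc A ∷ β) D then δ i j (stat D) else 0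

  lhsAt : Bool → DecPath → ℕ
  lhsAt false D = if row₀Decorated D then 0 else lhs D
  lhsAt true D = if row₀Decorated D then lhs D else 0

  rhs : DecPath → List ℕ → ℕ
  rhs D γ = if inCat k (β ++ γ) D then δ i j (dinvDec D + length β , areaDec D + A) else 0

  lhs-split : ∀ D → lhs D ≡ lhsAt false D + lhsAt true D
  lhs-split D with row₀Decorated D
  ... | true = refl
  ... | false = sym (+-identityʳ _)

  lhsAt-pos : ∀ d₀ D → 0 < lhsAt d₀ D → row₀Decorated D ≡ d₀ × peakDec D ≡ k × riseComp D ≡ suc A ∷ β
  lhsAt-pos false D pos with row₀Decorated D
  ... | false = refl , inCat⁻ {k} {suc A ∷ β} {D} (if-pos (inCat k (suc A ∷ β) D) pos)
  lhsAt-pos true D pos with row₀Decorated D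
  ... | true = refl , inCat⁻ {k} {suc A ∷ β} {D} (if-pos (inCat k (suc A ∷ β) D) pos)

  lhsAt-val : ∀ d₀ D → row₀Decorated D ≡ d₀ → peakDec D ≡ k → riseComp D ≡ suc A ∷ β → lhsAt d₀ D ≡ δ i j (stat D)
  lhsAt-val false D e p q rewrite e | inCat⁺ {k} {suc A ∷ β} {D} p q = refl
  lhsAt-val true D e p q rewrite e | inCat⁺ {k} {suc A ∷ β} {D} p q = refl

  ∑rhs-single : ∀ D {n γ₀} → γ₀ ∈ compositions n → peakDec D ≡ k → riseComp D ≡ β ++ γ₀ →
    ∑ (rhs D) (compositions n) ≡ δ i j (dinvDec D + length β , areaDec D + A)
  ∑rhs-single D {n} {γ₀} γ₀∈ p q = trans (∑-single (rhs D) (compositions-unique n) γ₀∈ other-γ) (cong (λ b → if b then _ else 0) (inCat⁺ {k} {β ++ γ₀} {D} p q))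
    where
    other-γ : ∀ {γ} → γ ∈ compositions n → γ ≢ γ₀ → rhs D γ ≡ 0
    other-γ {γ} _ γ≢γ₀ rewrite dec-false (≡-dec _≟_ (riseComp D) (β ++ γ)) (λ e → γ≢γ₀ (sym (++-cancelˡ β γ₀ γ (trans (sym q) e))))
      with does (peakDec D ≟ k)
    ... | true = refl
    ... | false = refl

  stat-glue : ∀ R d₀ → Rotation.firstPart R d₀ ≡ suc A → occ 0 (FirstReturn.r R) ≡ length β →
    stat (glue d₀ R) ≡ (dinvDec (rotate R) + length β , areaDec (rotate R) + A)
  stat-glue R d₀ firstPart≡ occβ = cong₂ _,_ (trans dinvDec-rotate (cong (dinvDec (rotate R) +_) occβ)) (areaDec-rotate A firstPart≡)
    where open Rotation R d₀

  unrotatePath-rotate′ : ∀ R d₀ → occ 0 (FirstReturn.r R) ≡ length β → unrotatePath (length β) d₀ (rotate R) ≡ glue d₀ R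
  unrotatePath-rotate′ R d₀ occβ = subst (λ n → unrotatePath n d₀ (rotate R) ≡ glue d₀ R) occβ (Rotation.unrotatePath-rotate R d₀)

  lastSize : Bool → ℕ
  lastSize d₀ = if d₀ then suc A else A

  lastSize-positive : 1 ≤ A → ∀ d₀ → 1 ≤ lastSize d₀
  lastSize-positive 1≤A false = 1≤A
  lastSize-positive 1≤A true = s≤s z≤n

  rotatePath-support : 1 ≤ A → ∀ d₀ N {D} → D ∈ decoratedPaths (suc N) → 0 < lhsAt d₀ D →
    rotatePath D ∈ decoratedPaths N × ∑ (rhs (rotatePath D)) (compositions (lastSize d₀)) ≡ lhsAt d₀ D
      × unrotatePath (length β) d₀ (rotatePath D) ≡ D
  rotatePath-support 1≤A d₀ N {a , d} D∈ pos with lhsAt-pos d₀ (a , d) pos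
  ... | deco , peak , comp with glue-of-firstPart≥2 N D∈ comp (s≤s 1≤A)
  ... | d₀′ , R , refl with deco
  ... | refl = subst (λ D′ → D′ ∈ decoratedPaths N × ∑ (rhs D′) (compositions (lastSize d₀)) ≡ lhsAt d₀ (glue d₀ R)
                      × unrotatePath (length β) d₀ D′ ≡ glue d₀ R)
    (sym rotatePath-glue) (∈-glue⇒∈-rotate {N} D∈ , weight , unrotatePath-rotate′ R d₀ occβ)
    where
    open Rotation R d₀
    firstPart≡ : firstPart ≡ suc A
    firstPart≡ = ∷-injectiveˡ (trans (sym riseComp-glue) comp)
    middle : compositionOf RR ≡ β
    middle = ∷-injectiveʳ (trans (sym riseComp-glue) comp)
    occβ : occ 0 (FirstReturn.r R) ≡ length β
    occβ = trans (sym length-compositionOf-RR) (cong length middle)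
    weight : ∑ (rhs (rotate R)) (compositions (lastSize d₀)) ≡ lhsAt d₀ (glue d₀ R)
    weight = begin
        ∑ (rhs (rotate R)) (compositions (lastSize d₀))
      ≡⟨ ∑rhs-single (rotate R) {lastSize d₀} (∈-compositions⁺ (lastSize d₀) lastParts-positive (trans sum-lastParts (∑partWeight-firstPart A firstPart≡)))
           (trans (sym peakDec-rotate) peak) (trans riseComp-rotate (cong (_++ lastParts) middle)) ⟩
        δ i j (dinvDec (rotate R) + length β , areaDec (rotate R) + A)
      ≡⟨ cong (δ i j) (sym (stat-glue R d₀ firstPart≡ occβ)) ⟩
        δ i j (stat (glue d₀ R))
      ≡⟨ sym (lhsAt-val d₀ (glue d₀ R) refl peak comp) ⟩
        lhsAt d₀ (glue d₀ R) ∎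
      where open ≡-Reasoning

  unrotatePath-support : 1 ≤ A → ∀ d₀ N {D} → D ∈ decoratedPaths N → 0 < ∑ (rhs D) (compositions (lastSize d₀)) →
    unrotatePath (length β) d₀ D ∈ decoratedPaths (suc N) × lhsAt d₀ (unrotatePath (length β) d₀ D) ≡ ∑ (rhs D) (compositions (lastSize d₀))
      × rotatePath (unrotatePath (length β) d₀ D) ≡ D
  unrotatePath-support 1≤A d₀ N {a , d} D∈ pos with ∑-pos⇒∃ (rhs (a , d)) (compositions (lastSize d₀)) pos
  ... | γ , γ∈ , pos-γ with inCat⁻ {k} {β ++ γ} {a , d} (if-pos (inCat k (β ++ γ) (a , d)) pos-γ)
  ... | peak , comp with rotation-of-riseComp N D∈ comp (compositions-nonempty (lastSize-positive 1≤A d₀) γ∈)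
  ... | R , refl , occβ = subst (λ D → D ∈ decoratedPaths (suc N) × lhsAt d₀ D ≡ ∑ (rhs (rotate R)) (compositions (lastSize d₀))
                                    × rotatePath D ≡ rotate R)
    (sym (unrotatePath-rotate′ R d₀ occβ)) (∈-rotate⇒∈-glue {N} D∈ , weight , rotatePath-glue)
    where
    open Rotation R d₀
    parts = ++-split (compositionOf RR) β lastParts γ (trans length-compositionOf-RR occβ) (trans (sym riseComp-rotate) comp)
    firstPart≡ : firstPart ≡ suc A
    firstPart≡ = firstPart-∑partWeight A (trans (sym sum-lastParts) (trans (cong sum (proj₂ parts)) (proj₁ (∈-compositions⁻ (lastSize d₀) γ∈))))
    weight : lhsAt d₀ (glue d₀ R) ≡ ∑ (rhs (rotate R)) (compositions (lastSize d₀))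
    weight = begin
        lhsAt d₀ (glue d₀ R)
      ≡⟨ lhsAt-val d₀ (glue d₀ R) refl (trans peakDec-rotate peak) (trans riseComp-glue (cong₂ _∷_ firstPart≡ (proj₁ parts))) ⟩
        δ i j (stat (glue d₀ R))
      ≡⟨ cong (δ i j) (stat-glue R d₀ firstPart≡ occβ) ⟩
        δ i j (dinvDec (rotate R) + length β , areaDec (rotate R) + A)
      ≡⟨ sym (∑rhs-single (rotate R) {lastSize d₀} γ∈ peak comp) ⟩
        ∑ (rhs (rotate R)) (compositions (lastSize d₀)) ∎
      where open ≡-Reasoning

  rotation-bijection : 1 ≤ A → ∀ d₀ N →
    ∑ (lhsAt d₀) (decoratedPaths (suc N)) ≡ ∑ (λ D → ∑ (rhs D) (compositions (lastSize d₀))) (decoratedPaths N)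
  rotation-bijection 1≤A d₀ N = ∑-bijection (×-≡-dec (≡-dec _≟_) (≡-dec _≟ᴮ_)) rotatePath (unrotatePath (length β) d₀)
    (decoratedPaths-unique (suc N)) (decoratedPaths-unique N) (lhsAt d₀) (λ D → ∑ (rhs D) (compositions (lastSize d₀)))
    (rotatePath-support 1≤A d₀ N) (unrotatePath-support 1≤A d₀ N)

  -- With ℓ = 0 the parts add up to the size, which leaves no room for a decorated double rise at row 0.
  ∑lhsAt-true-ℓ≡0 : 1 ≤ A → ∀ N → N ≡ A + sum β → ∑ (lhsAt true) (decoratedPaths (suc N)) ≡ 0
  ∑lhsAt-true-ℓ≡0 1≤A N size = ∑-zero (decoratedPaths (suc N)) vanish
    where
    vanish : ∀ {D} → D ∈ decoratedPaths (suc N) → lhsAt true D ≡ 0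
    vanish {D} D∈ with lhsAt true D in eq
    ... | zero = refl
    ... | suc _ with lhsAt-pos true D (subst (0 <_) (sym eq) z<s)
    ... | deco , _ , comp with glue-of-firstPart≥2 N D∈ comp (s≤s 1≤A)
    ... | d₀ , R , refl with deco
    ... | refl = ⊥-elim (m+1+n≢m (suc A + sum β) (begin
        suc A + sum β + suc (∑ decoratedRise RS + ∑ decoratedRise RR)
      ≡⟨ cong (sum (suc A ∷ β) +_) (sym (∑-rows-glue decoratedRise)) ⟩
        sum (suc A ∷ β) + ∑ decoratedRise (rows (glue true R))
      ≡⟨ cong (λ α → sum α + ∑ decoratedRise (rows (glue true R))) (sym comp) ⟩
        sum (riseComp (glue true R)) + ∑ decoratedRise (rows (glue true R))
      ≡⟨ sum-riseComp heights decos length-glue refl ⟩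
        length heights
      ≡⟨ proj₁ (∈-decoratedPaths⁻ (suc N) D∈) ⟩
        suc N
      ≡⟨ cong suc size ⟩
        suc A + sum β ∎))
      where
      open Rotation R true
      open ≡-Reasoning

  coeff-lhs : ∀ ℓ → coeff (CatRise (suc A ∷ β) k ℓ) i j ≡ ∑ lhs (decoratedPaths (suc (A + sum β + ℓ)))
  coeff-lhs ℓ = coeff-CatRise (suc A ∷ β) k ℓ i j

  coeff-rhs : ∀ n ℓ′ N → (∀ {γ} → γ ∈ compositions n → sum (β ++ γ) + ℓ′ ≡ N) →
    coeff (qtShift (length β) A (sumComps n (λ γ → CatRise (β ++ γ) k ℓ′))) i j ≡ ∑ (λ D → ∑ (rhs D) (compositions n)) (decoratedPaths N)
  coeff-rhs n ℓ′ N size = begin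
      coeff (qtShift (length β) A (sumComps n (λ γ → CatRise (β ++ γ) k ℓ′))) i j
    ≡⟨ coeff-qtShift-sumComps (length β) A n (λ γ → CatRise (β ++ γ) k ℓ′) i j ⟩
      ∑ (λ γ → ∑ (λ m → δ i j (proj₁ m + length β , proj₂ m + A)) (CatRise (β ++ γ) k ℓ′)) (compositions n)
    ≡⟨ ∑-cong-∈ (compositions n) (λ {γ} γ∈ → trans (∑-map (λ m → δ i j (proj₁ m + length β , proj₂ m + A)) stat (filterᵇ (inCat k (β ++ γ)) (paths γ)))
         (trans (∑-filterᵇ (λ D → δ i j (dinvDec D + length β , areaDec D + A)) (inCat k (β ++ γ)) (paths γ))
         (cong (λ N′ → ∑ (λ D → rhs D γ) (decoratedPaths N′)) (size γ∈)))) ⟩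
      ∑ (λ γ → ∑ (λ D → rhs D γ) (decoratedPaths N)) (compositions n)
    ≡⟨ ∑-swap (λ γ D → rhs D γ) (compositions n) (decoratedPaths N) ⟩
      ∑ (λ D → ∑ (rhs D) (compositions n)) (decoratedPaths N) ∎
    where
    open ≡-Reasoning
    paths : List ℕ → List DecPath
    paths γ = decoratedPaths (sum (β ++ γ) + ℓ′)

  sum-++-composition : ∀ {n γ} ℓ′ → γ ∈ compositions n → sum (β ++ γ) + ℓ′ ≡ sum β + n + ℓ′
  sum-++-composition {n} {γ} ℓ′ γ∈ = cong (_+ ℓ′) (trans (sum-++ β γ) (cong (sum β +_) (proj₁ (∈-compositions⁻ n γ∈))))

  ∑lhsAt-false : 1 ≤ A → ∀ ℓ → ∑ (lhsAt false) (decoratedPaths (suc (A + sum β + ℓ)))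
    ≡ coeff (qtShift (length β) A (sumComps A (λ γ → CatRise (β ++ γ) k ℓ))) i j
  ∑lhsAt-false 1≤A ℓ = trans (rotation-bijection 1≤A false (A + sum β + ℓ))
    (sym (coeff-rhs A ℓ (A + sum β + ℓ) (λ γ∈ → trans (sum-++-composition ℓ γ∈) (cong (_+ ℓ) (+-comm (sum β) A)))))

  ∑lhsAt-true : 1 ≤ A → ∀ ℓ → ∑ (lhsAt true) (decoratedPaths (suc (A + sum β + ℓ)))
    ≡ coeff (qtShift (length β) A (sumComps (suc A) (λ γ → CatRisePred (β ++ γ) k ℓ))) i j
  ∑lhsAt-true 1≤A zero = trans (∑lhsAt-true-ℓ≡0 1≤A _ (+-identityʳ _))
    (sym (trans (coeff-qtShift-sumComps (length β) A (suc A) (λ _ → []) i j) (∑-zero (compositions (suc A)) (λ _ → refl))))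
  ∑lhsAt-true 1≤A (suc ℓ) = trans (rotation-bijection 1≤A true (A + sum β + suc ℓ))
    (sym (coeff-rhs (suc A) ℓ (A + sum β + suc ℓ) (λ γ∈ → trans (sum-++-composition ℓ γ∈) (arith (sum β) A ℓ))))
    where
    arith : ∀ b A ℓ → b + suc A + ℓ ≡ A + b + suc ℓ
    arith = solve-∀

proposition3p3 : (a k ℓ : ℕ) (β : List ℕ) → 1 ≤ a → All (0 <_) β →
    CatRise (suc a ∷ β) k ℓ
      ≈P (qtShift (length β) a (sumComps a (λ γ → CatRise (β ++ γ) k ℓ))
          ++ qtShift (length β) a (sumComps (suc a) (λ γ → CatRisePred (β ++ γ) k ℓ)))
proposition3p3 a k ℓ β 1≤a _ i j = begin
    coeff (CatRise (suc a ∷ β) k ℓ) i j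
  ≡⟨ coeff-lhs ℓ ⟩
    ∑ lhs paths
  ≡⟨ trans (∑-cong-∈ paths (λ {D} _ → lhs-split D)) (∑-+ (lhsAt false) (lhsAt true) paths) ⟩
    ∑ (lhsAt false) paths + ∑ (lhsAt true) paths
  ≡⟨ cong₂ _+_ (∑lhsAt-false 1≤a ℓ) (∑lhsAt-true 1≤a ℓ) ⟩
    coeff P₁ i j + coeff P₂ i j
  ≡⟨ sym (coeff-++ P₁ P₂ i j) ⟩
    coeff (P₁ ++ P₂) i j ∎
  where
  open ≡-Reasoning
  open Counting a k β i j
  paths = decoratedPaths (suc (a + sum β + ℓ))
  P₁ = qtShift (length β) a (sumComps a (λ γ → CatRise (β ++ γ) k ℓ))
  P₂ = qtShift (length β) a (sumComps (suc a) (λ γ → CatRisePred (β ++ γ) k ℓ))
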